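{- Let $d>1$ be an integer and $q$ a prime power with $\gcd(q,d)=1$. Let $u_1,u_2\in\mathbb{F}_q^\ast$ and let $m$ be a positive integer. Then the polynomial $$f(x)=u_1(x^q-x)+u_2\left(x+x^q+\cdots+x^{q^{d-1}}\right)^m$$ is a permutation polynomial of $\mathbb{F}_{q^d}$ if and only if $\gcd(m,q-1)=1$. Moreover, if $f$ is a permutation polynomial of $\mathbb{F}_{q^d}$, then its compositional inverse on $\mathbb{F}_{q^d}$ is $$f^{ -1}(x)=\frac1d(u_2d)^{ -r}\left(x+x^q+\cdots+x^{q^{d-1}}\right)^r+\frac{d-1}{2du_1}\left(x+x^q+\cdots+x^{q^{d-1}}\right)-\frac{1}{du_1}\sum_{i=1}^{d-1}i\,x^{q^{d-1-i}},$$ where $r$ is a positive integer with $mr\equiv 1\pmod{q-1}$.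
   Context: A polynomial $f\in\mathbb{F}_Q[x]$ is a permutation polynomial of $\mathbb{F}_Q$ if $a\mapsto f(a)$ is a bijection of $\mathbb{F}_Q$; its compositional inverse is the (polynomial representing the) inverse map. -}

module Defs where

open import Level using (Level; _⊔_)
open import Data.Nat as ℕ using (ℕ; zero; suc; _∸_; _<_; _%_; _/_)
open import Data.Nat.Primality using (Prime)
open import Data.Fin using (Fin)
open import Data.Product using (Σ; ∃; _×_; _,_)
open import Relation.Nullary using (¬_)
open import Relation.Binary.PropositionalEquality using (_≡_)
open import Function.Definitions using (Bijective)
open import Algebra.Bundles using (CommutativeRing; Semiring)

IsPrimePower : ℕ → Set
IsPrimePower q = Σ ℕ λ p → Σ ℕ λ k → Prime p × (0 < k) × (q ≡ p ℕ.^ k)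

module _ {c ℓ : Level} (K : CommutativeRing c ℓ) where
  open CommutativeRing K
  open import Algebra.Definitions.RawSemiring (Semiring.rawSemiring semiring) public using (_^_) renaming (_×_ to _·ℕ_)

  IsField : Set (c ⊔ ℓ)
  IsField = (¬ (1# ≈ 0#)) × (∀ x → ¬ (x ≈ 0#) → ∃ λ y → (x * y) ≈ 1#)

  HasCard : ℕ → Set (c ⊔ ℓ)
  HasCard n = Σ (Fin n → Carrier) λ e → Bijective _≡_ _≈_ e

  IsPermutation : (Carrier → Carrier) → Set (c ⊔ ℓ)
  IsPermutation g = Bijective _≈_ _≈_ g

  Σ< : ℕ → (ℕ → Carrier) → Carrier
  Σ< zero    h = 0#
  Σ< (suc n) h = Σ< n h + h n

  Tr : ℕ → ℕ → Carrier → Carrier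
  Tr q d x = Σ< d (λ i → x ^ (q ℕ.^ i))

  fPoly : (q d m : ℕ) (u₁ u₂ : Carrier) → Carrier → Carrier
  fPoly q d m u₁ u₂ x = (u₁ * ((x ^ q) - x)) + (u₂ * (Tr q d x ^ m))

  -- (n ·ℕ a = a + ... + a, n times)
  -- The element "(d-1)/2" of K: ⌊(d-1)/2⌋·1, plus ½ (given as t with t+t = 1) when d is even.
  -- (If d is odd this is the integer (d-1)/2; if d is even then q is odd, so 2 is invertible.)
  halfDm1 : ℕ → Carrier → Carrier
  halfDm1 d t with d % 2
  ... | zero  = (((d ∸ 1) / 2) ·ℕ 1#) + t
  ... | suc _ = ((d ∸ 1) / 2) ·ℕ 1#

  -- f⁻¹(x) = (1/d)(u₂d)^{-r} Tr(x)^r + ((d-1)/(2 d u₁)) Tr(x) - (1/(d u₁)) ∑_{i=1}^{d-1} i x^{q^{d-1-i}}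
  -- dinv = 1/d, w = (u₂ d)^{-1}, uinv = 1/u₁, t = 1/2 (when d even)
  gPoly : (q d r : ℕ) (dinv w uinv t : Carrier) → Carrier → Carrier
  gPoly q d r dinv w uinv t x =
    ((dinv * (w ^ r)) * (Tr q d x ^ r))
    + ((((halfDm1 d t) * dinv) * uinv) * Tr q d x)
    - ((dinv * uinv) * Σ< (d ∸ 1) (λ j → (suc j) ·ℕ (x ^ (q ℕ.^ (d ∸ 1 ∸ suc j)))))

{-# OPTIONS --safe #-}
module Submission where

-- Write T x = x + x^q + ⋯ + x^{q^{d-1}} for the trace of 𝔽_{q^d} over 𝔽_q. Since the q-th
-- power map is additive and fixes 𝔽_q, T is 𝔽_q-linear, T(x^q - x) = 0 and T(c) = d c on
-- 𝔽_q; hence T(f x) = d u₂ T(x)^m. When m r ≡ 1 (mod q - 1) this recovers T(x) from f(x),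
-- and a telescoping sum over the conjugates x^{q^i} then recovers x itself: that is the
-- formula g, and g ∘ f = id makes f injective, hence bijective on the finite field.
-- Conversely, if ℓ = gcd(m, q - 1) > 1, some y ∈ 𝔽_q has y ≠ 1 = y^ℓ (a polynomial of degree
-- 1 + (q^d - 1)/ℓ cannot vanish on the whole field), and for T(x₀) ≠ 0 the point
-- x₀ + (y - 1) T(x₀) / d has the same image under f as x₀.

open import Defs hiding (_^_; _·ℕ_)
open import Level using (Level; _⊔_)
open import Algebra.Bundles using (CommutativeRing)
open import Data.Nat as ℕ using (ℕ; zero; suc; _∸_; _<_; _%_)
import Data.Nat.Properties as ℕP
open import Data.Nat.Divisibility using (_∣_; divides)
open import Data.Nat.GCD using (gcd)
import Data.Nat.Primality
open import Data.Fin as Fin using (Fin)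
import Data.Fin.Properties as FinP
open import Data.Product using (Σ; ∃; _,_; proj₁; proj₂) renaming (_×_ to _∧_)
open import Data.Sum using (_⊎_; inj₁; inj₂)
open import Data.Empty using (⊥-elim)
open import Relation.Nullary using (¬_; Dec; yes; no)
open import Relation.Binary.PropositionalEquality as ≡ using (_≡_; _≢_)
open import Function.Base using (_∘_)
open import Function.Bundles using (_⇔_; mk⇔)
open import Function.Definitions using (Bijective; Injective; Surjective)

module _ {c ℓ} (K : CommutativeRing c ℓ) where
  open CommutativeRing K
  open import Algebra.Properties.Semiring.Mult semiring using (_×_)
  open import Algebra.Properties.Semiring.Exp semiring using (_^_)

  Additive-^ : ℕ → Set (c ⊔ ℓ)
  Additive-^ E = ∀ a b → (a + b) ^ E ≈ a ^ E + b ^ E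

  Fixed-^ : ℕ → Carrier → Set ℓ
  Fixed-^ E a = a ^ E ≈ a

  CharacteristicDivides : ℕ → Set ℓ
  CharacteristicDivides p = p × 1# ≈ 0#

module ℤ-Solver {c ℓ} (K : CommutativeRing c ℓ) where
  open CommutativeRing K
  open import Algebra.Solver.Ring.AlmostCommutativeRing
    using (fromCommutativeRing; _-Raw-AlmostCommutative⟶_)
  open import Algebra.Properties.Semiring.Mult.TCOptimised semiring using (_×_; 1+×; ×-homo-+; ×1-homo-*)
  open import Algebra.Properties.Ring ring using (-0#≈0#; -‿involutive; -‿distribˡ-*; -‿distribʳ-*)
  open import Algebra.Properties.AbelianGroup +-abelianGroup using (⁻¹-∙-comm)
  open import Relation.Binary.Reasoning.Setoid setoid
  import Algebra.Solver.CommutativeMonoid +-commutativeMonoid as +-Solver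
  open import Data.Maybe using (Maybe; just; nothing)
  open import Data.Integer as ℤ using (ℤ; +_; -[1+_]; +[1+_])
  import Data.Integer.Properties as ℤP

  -- The type-checking-optimised _×_ makes :0 and :1 below evaluate to exactly 0# and 1#.
  ⟦_⟧ᶻ : ℤ → Carrier
  ⟦ + n ⟧ᶻ      = n × 1#
  ⟦ -[1+ n ] ⟧ᶻ = - (suc n × 1#)

  -‿homo : ∀ i → ⟦ ℤ.- i ⟧ᶻ ≈ - ⟦ i ⟧ᶻ
  -‿homo (+ zero)  = sym -0#≈0#
  -‿homo +[1+ n ]  = refl
  -‿homo -[1+ n ]  = sym (-‿involutive _)

  -‿distrib-+ : ∀ a b → - (a + b) ≈ - a - b
  -‿distrib-+ a b = sym (⁻¹-∙-comm a b)

  ⊖-homo : ∀ m n → ⟦ m ℤ.⊖ n ⟧ᶻ ≈ m × 1# - n × 1#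
  ⊖-homo m       zero    = sym (trans (+-congˡ -0#≈0#) (+-identityʳ _))
  ⊖-homo zero    (suc n) = sym (+-identityˡ _)
  ⊖-homo (suc m) (suc n) = begin
    ⟦ suc m ℤ.⊖ suc n ⟧ᶻ              ≡⟨ ≡.cong ⟦_⟧ᶻ (ℤP.[1+m]⊖[1+n]≡m⊖n m n) ⟩
    ⟦ m ℤ.⊖ n ⟧ᶻ                      ≈⟨ ⊖-homo m n ⟩
    m × 1# - n × 1#                   ≈⟨ sym (+-identityˡ _) ⟩
    0# + (m × 1# - n × 1#)            ≈⟨ +-congʳ (sym (-‿inverseʳ 1#)) ⟩
    (1# - 1#) + (m × 1# - n × 1#)     ≈⟨ +-Solver.solve 4 (λ x y z w → (x ⊕ y) ⊕ (z ⊕ w) ⊜ (x ⊕ z) ⊕ (y ⊕ w))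
                                           refl 1# (- 1#) (m × 1#) (- (n × 1#)) ⟩
    (1# + m × 1#) + (- 1# - n × 1#)   ≈⟨ +-congˡ (sym (-‿distrib-+ 1# (n × 1#))) ⟩
    (1# + m × 1#) - (1# + n × 1#)     ≈⟨ sym (+-cong (1+× m 1#) (-‿cong (1+× n 1#))) ⟩
    suc m × 1# - suc n × 1#           ∎
    where open +-Solver using (_⊕_; _⊜_)

  +-homo : ∀ i j → ⟦ i ℤ.+ j ⟧ᶻ ≈ ⟦ i ⟧ᶻ + ⟦ j ⟧ᶻ
  +-homo (+ m)    (+ n)    = ×-homo-+ 1# m n
  +-homo (+ m)    -[1+ n ] = ⊖-homo m (suc n)
  +-homo -[1+ m ] (+ n)    = trans (⊖-homo n (suc m)) (+-comm _ _)
  +-homo -[1+ m ] -[1+ n ] = begin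
    - (suc (suc (m ℕ.+ n)) × 1#)        ≡⟨ ≡.cong (λ k → - (suc k × 1#)) (≡.sym (ℕP.+-suc m n)) ⟩
    - ((suc m ℕ.+ suc n) × 1#)          ≈⟨ -‿cong (×-homo-+ 1# (suc m) (suc n)) ⟩
    - (suc m × 1# + suc n × 1#)         ≈⟨ -‿distrib-+ _ _ ⟩
    - (suc m × 1#) - suc n × 1#         ∎

  +*+-homo : ∀ m n → ⟦ + m ℤ.* + n ⟧ᶻ ≈ ⟦ + m ⟧ᶻ * ⟦ + n ⟧ᶻ
  +*+-homo m n = trans (reflexive (≡.cong ⟦_⟧ᶻ (≡.sym (ℤP.pos-* m n)))) (×1-homo-* m n)

  *-homo : ∀ i j → ⟦ i ℤ.* j ⟧ᶻ ≈ ⟦ i ⟧ᶻ * ⟦ j ⟧ᶻ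
  *-homo (+ m) (+ n) = +*+-homo m n
  *-homo (+ m) -[1+ n ] = begin
    ⟦ + m ℤ.* ℤ.- (+ suc n) ⟧ᶻ      ≡⟨ ≡.cong ⟦_⟧ᶻ (≡.sym (ℤP.neg-distribʳ-* (+ m) (+ suc n))) ⟩
    ⟦ ℤ.- (+ m ℤ.* + suc n) ⟧ᶻ      ≈⟨ -‿homo (+ m ℤ.* + suc n) ⟩
    - ⟦ + m ℤ.* + suc n ⟧ᶻ          ≈⟨ -‿cong (+*+-homo m (suc n)) ⟩
    - (⟦ + m ⟧ᶻ * ⟦ + suc n ⟧ᶻ)     ≈⟨ -‿distribʳ-* _ _ ⟩
    ⟦ + m ⟧ᶻ * - ⟦ + suc n ⟧ᶻ       ∎
  *-homo -[1+ m ] (+ n) = begin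
    ⟦ ℤ.- (+ suc m) ℤ.* + n ⟧ᶻ      ≡⟨ ≡.cong ⟦_⟧ᶻ (≡.sym (ℤP.neg-distribˡ-* (+ suc m) (+ n))) ⟩
    ⟦ ℤ.- (+ suc m ℤ.* + n) ⟧ᶻ      ≈⟨ -‿homo (+ suc m ℤ.* + n) ⟩
    - ⟦ + suc m ℤ.* + n ⟧ᶻ          ≈⟨ -‿cong (+*+-homo (suc m) n) ⟩
    - (⟦ + suc m ⟧ᶻ * ⟦ + n ⟧ᶻ)     ≈⟨ -‿distribˡ-* _ _ ⟩
    - ⟦ + suc m ⟧ᶻ * ⟦ + n ⟧ᶻ       ∎
  *-homo -[1+ m ] -[1+ n ] = begin
    ⟦ + suc m ℤ.* + suc n ⟧ᶻ        ≈⟨ +*+-homo (suc m) (suc n) ⟩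
    ⟦ + suc m ⟧ᶻ * ⟦ + suc n ⟧ᶻ     ≈⟨ sym (-‿involutive _) ⟩
    - - (⟦ + suc m ⟧ᶻ * ⟦ + suc n ⟧ᶻ) ≈⟨ -‿cong (-‿distribˡ-* _ _) ⟩
    - (- ⟦ + suc m ⟧ᶻ * ⟦ + suc n ⟧ᶻ) ≈⟨ -‿distribʳ-* _ _ ⟩
    - ⟦ + suc m ⟧ᶻ * - ⟦ + suc n ⟧ᶻ ∎

  ℤ⟶K : ℤ.+-*-rawRing -Raw-AlmostCommutative⟶ fromCommutativeRing K
  ℤ⟶K = record
    { ⟦_⟧ = ⟦_⟧ᶻ ; +-homo = +-homo ; *-homo = *-homo ; -‿homo = -‿homo
    ; 0-homo = refl ; 1-homo = refl }

  ⟦⟧-equal? : ∀ i j → Maybe (⟦ i ⟧ᶻ ≈ ⟦ j ⟧ᶻ)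
  ⟦⟧-equal? i j with i ℤ.≟ j
  ... | yes ≡.refl = just refl
  ... | no _       = nothing

  open import Algebra.Solver.Ring ℤ.+-*-rawRing (fromCommutativeRing K) ℤ⟶K ⟦⟧-equal? public

  :0 :1 : ∀ {k} → Polynomial k
  :0 = con (+ 0)
  :1 = con (+ 1)

module Arithmetic where
  open import Data.Nat
  open import Data.Nat.Properties
  open import Data.Nat.Divisibility
  open import Data.Nat.DivMod
  open import Data.Nat.Primality
  open import Data.Nat.Combinatorics
  open import Data.Nat.GCD using (module Bézout)
  open import Data.Nat.Coprimality using (gcd≡1⇒coprime; coprime-Bézout)
  open import Data.Nat.Tactic.RingSolver using (solve-∀; solve)
  open import Data.List using ([]; _∷_)
  open import Relation.Binary.PropositionalEquality
  open ≡-Reasoning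

  prime∤1 : ∀ {p} → Prime p → ¬ (p ∣ 1)
  prime∤1 {p} p-prime p∣1 with ∣1⇒≡1 p∣1
  ... | refl = ⊥-elim (NonTrivial.nonTrivial (prime⇒nonTrivial p-prime))

  prime∤! : ∀ {p} m → Prime p → m < p → ¬ (p ∣ m !)
  prime∤! zero    p-prime _   p∣1 = prime∤1 p-prime p∣1
  prime∤! (suc m) p-prime m<p p∣m! with euclidsLemma (suc m) (m !) p-prime p∣m!
  ... | inj₁ p∣1+m = <⇒≱ m<p (∣⇒≤ p∣1+m)
  ... | inj₂ p∣m!  = prime∤! m p-prime (<-trans (n<1+n m) m<p) p∣m!

  prime∣binomial : ∀ {p k} → Prime p → 0 < k → k < p → p ∣ p C k
  prime∣binomial {p} {k} p-prime 0<k k<p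
    with euclidsLemma (k ! * (p ∸ k) !) (p C k) p-prime p∣k![p∸k]!*pCk
    where
    instance _ = k !* (p ∸ k) !≢0
    p∣p! : ∀ p → .{{NonZero p}} → p ∣ p !
    p∣p! (suc m) = m∣m*n (m !)
    p∣k![p∸k]!*pCk : p ∣ (k ! * (p ∸ k) !) * (p C k)
    p∣k![p∸k]!*pCk = subst (p ∣_)
      (sym (trans (cong ((k ! * (p ∸ k) !) *_) (nCk≡n!/k![n-k]! (<⇒≤ k<p))) (m*[n/m]≡n (k![n∸k]!∣n! (<⇒≤ k<p)))))
      (p∣p! p {{prime⇒nonZero p-prime}})
  ... | inj₂ p∣pCk = p∣pCk
  ... | inj₁ p∣k![p∸k]! with euclidsLemma (k !) ((p ∸ k) !) p-prime p∣k![p∸k]!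
  ...   | inj₁ p∣k!     = ⊥-elim (prime∤! k p-prime k<p p∣k!)
  ...   | inj₂ p∣[p∸k]! = ⊥-elim (prime∤! (p ∸ k) p-prime (∸-monoʳ-< 0<k (<⇒≤ k<p)) p∣[p∸k]!)

  ≢0∧≢1⇒2≤ : ∀ {k} → k ≢ 0 → k ≢ 1 → 2 ≤ k
  ≢0∧≢1⇒2≤ {zero}        k≢0 _   = ⊥-elim (k≢0 refl)
  ≢0∧≢1⇒2≤ {suc zero}    _   k≢1 = ⊥-elim (k≢1 refl)
  ≢0∧≢1⇒2≤ {suc (suc _)} _   _   = s≤s (s≤s z≤n)

  m∣m^n : ∀ m {n} → 1 ≤ n → m ∣ m ^ n
  m∣m^n m {suc n} _ = divides (m ^ n) (*-comm m (m ^ n))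

  even-or-odd : ∀ n → ∃ λ h → n ≡ h + h ⊎ n ≡ suc (h + h)
  even-or-odd zero = 0 , inj₁ refl
  even-or-odd (suc n) with even-or-odd n
  ... | h , inj₁ n≡2h   = h , inj₂ (cong suc n≡2h)
  ... | h , inj₂ n≡1+2h = suc h , inj₁ (trans (cong suc n≡1+2h) (cong suc (sym (+-suc h h))))

  h+h≡h*2 : ∀ h → h + h ≡ h * 2
  h+h≡h*2 h = solve (h ∷ [])

  [1+h+h]%2≡1 : ∀ h → suc (h + h) % 2 ≡ 1
  [1+h+h]%2≡1 h rewrite h+h≡h*2 h = [m+kn]%n≡m%n 1 h 2

  [2+h+h]%2≡0 : ∀ h → suc (suc (h + h)) % 2 ≡ 0
  [2+h+h]%2≡0 h = trans (cong (_% 2) (trans (cong suc (sym (+-suc h h))) (h+h≡h*2 (suc h)))) ([m+kn]%n≡m%n 0 (suc h) 2)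

  [h+h]/2≡h : ∀ h → (h + h) / 2 ≡ h
  [h+h]/2≡h h rewrite h+h≡h*2 h = m*n/n≡m h 2

  [1+h+h]/2≡h : ∀ h → suc (h + h) / 2 ≡ h
  [1+h+h]/2≡h h rewrite h+h≡h*2 h = trans (+-distrib-/ 1 (h * 2) 1%2+[h*2]%2<2) (m*n/n≡m h 2)
    where
    1%2+[h*2]%2<2 : 1 % 2 + (h * 2) % 2 < 2
    1%2+[h*2]%2<2 = subst (λ x → 1 % 2 + x < 2) (sym ([m+kn]%n≡m%n 0 h 2)) (s≤s (s≤s z≤n))

  triangle : ℕ → ℕ
  triangle zero    = 0
  triangle (suc n) = triangle n + suc n

  triangle+triangle : ∀ n → triangle n + triangle n ≡ n * suc n
  triangle+triangle zero    = refl
  triangle+triangle (suc n) = begin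
    (triangle n + suc n) + (triangle n + suc n) ≡⟨ lemma (triangle n) n ⟩
    (triangle n + triangle n) + 2 * suc n       ≡⟨ cong (_+ 2 * suc n) (triangle+triangle n) ⟩
    n * suc n + 2 * suc n                       ≡⟨ solve (n ∷ []) ⟩
    suc n * suc (suc n)                         ∎
    where
    lemma : ∀ a n → (a + suc n) + (a + suc n) ≡ (a + a) + 2 * suc n
    lemma = solve-∀

  h+h-injective : ∀ {a b} → a + a ≡ b + b → a ≡ b
  h+h-injective {a} {b} eq = *-cancelʳ-≡ a b 2 (trans (sym (h+h≡h*2 a)) (trans eq (h+h≡h*2 b)))

  triangle[h+h] : ∀ h → triangle (h + h) ≡ h * suc (h + h)
  triangle[h+h] h = h+h-injective (trans (triangle+triangle (h + h)) (solve (h ∷ [])))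

  triangle[1+h+h] : ∀ h → triangle (suc (h + h)) ≡ h * suc (suc (h + h)) + suc h
  triangle[1+h+h] h = h+h-injective (trans (triangle+triangle (suc (h + h))) (solve (h ∷ [])))

  ∣1+u⇒∣u*u∸1 : ∀ {Q} u → Q ∣ suc u → Q ∣ u * u ∸ 1
  ∣1+u⇒∣u*u∸1         zero    _               = divides 0 refl
  ∣1+u⇒∣u*u∸1 {Q} (suc v) (divides y 2+v≡yQ) = divides (v * y) (begin
    suc v * suc v ∸ 1 ≡⟨ cong (_∸ 1) (lemma v) ⟩
    v * suc (suc v)   ≡⟨ cong (v *_) 2+v≡yQ ⟩
    v * (y * Q)       ≡⟨ sym (*-assoc v y Q) ⟩
    v * y * Q         ∎)
    where
    lemma : ∀ v → suc v * suc v ≡ suc (v * suc (suc v))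
    lemma = solve-∀

  -- A Bézout identity x m = 1 + y Q gives r = x; one of the form x m + 1 = y Q gives r = x² m,
  -- since then m r - 1 = (x m)² - 1 is divisible by x m + 1.
  ∃-inverse-mod : ∀ m Q → 1 ≤ m → gcd m Q ≡ 1 → ∃ λ r → 1 ≤ m * r ∧ Q ∣ m * r ∸ 1
  ∃-inverse-mod m Q 1≤m gcd≡1 with coprime-Bézout (gcd≡1⇒coprime gcd≡1)
  ... | Bézout.+- x y eq = x , subst (1 ≤_) 1+yQ≡mx (s≤s z≤n) , divides y (cong (_∸ 1) (sym 1+yQ≡mx))
    where
    1+yQ≡mx : suc (y * Q) ≡ m * x
    1+yQ≡mx = trans eq (*-comm x m)
  ... | Bézout.-+ zero y eq = 1 , subst (1 ≤_) (sym (*-identityʳ m)) 1≤m , subst (_∣ m * 1 ∸ 1) (sym Q≡1) (1∣ _)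
    where
    Q≡1 : Q ≡ 1
    Q≡1 = m*n≡1⇒n≡1 y Q (sym eq)
  ... | Bézout.-+ x@(suc _) y eq = x * u , 1≤m*r , subst (λ z → Q ∣ z ∸ 1) (sym m*r≡u*u) (∣1+u⇒∣u*u∸1 u (divides y eq))
    where
    u : ℕ
    u = x * m
    m*r≡u*u : m * (x * u) ≡ u * u
    m*r≡u*u = lemma x m
      where
      lemma : ∀ x m → m * (x * (x * m)) ≡ (x * m) * (x * m)
      lemma = solve-∀
    1≤u : 1 ≤ u
    1≤u = *-mono-≤ {1} {x} {1} {m} (s≤s z≤n) 1≤m
    1≤m*r : 1 ≤ m * (x * u)
    1≤m*r = subst (1 ≤_) (sym m*r≡u*u) (*-mono-≤ 1≤u 1≤u)

  [m∸1]∣[m^n∸1] : ∀ m n → (m ∸ 1) ∣ (m ^ n ∸ 1)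
  [m∸1]∣[m^n∸1] m       zero    = divides 0 refl
  [m∸1]∣[m^n∸1] zero    (suc n) = divides 0 refl
  [m∸1]∣[m^n∸1] (suc k) (suc n) with suc k ^ n | m^n≢0 (suc k) n | [m∸1]∣[m^n∸1] (suc k) n
  ... | suc j | _ | k∣j = subst (k ∣_) (lemma k j) (∣m∣n⇒∣m+n (divides (suc j) refl) k∣j)
    where
    lemma : ∀ k j → suc j * k + j ≡ suc k * suc j ∸ 1
    lemma k j = cong (_∸ 1) (lemma′ k j)
      where
      lemma′ : ∀ k j → suc (suc j * k + j) ≡ suc k * suc j
      lemma′ = solve-∀

  cofactor-bounds : ∀ N ℓ Q → 2 ≤ ℓ → 2 ≤ Q → N * ℓ ≡ Q ∸ 1 → 1 ≤ N ∧ 2 + N ≤ Q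
  cofactor-bounds zero    ℓ (suc zero)    _   (s≤s ()) _
  cofactor-bounds zero    ℓ (suc (suc Q)) _   _        ()
  cofactor-bounds (suc N) ℓ (suc Q)       2≤ℓ _ eq = s≤s z≤n , s≤s (subst (2 + N ≤_) eq 2+N≤[1+N]*ℓ)
    where
    2+N≤[1+N]*ℓ : 2 + N ≤ suc N * ℓ
    2+N≤[1+N]*ℓ = ≤-trans (subst (2 + N ≤_) (h+h≡h*2 (suc N)) (s≤s (m≤n+m (suc N) N))) (*-monoʳ-≤ (suc N) 2≤ℓ)

Fin-injective⇒surjective : ∀ {k} (φ : Fin k → Fin k) → Injective _≡_ _≡_ φ → ∀ j → ∃ λ i → φ i ≡ j
Fin-injective⇒surjective {suc k} φ φ-injective j with FinP.any? (λ i → φ i FinP.≟ j)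
... | yes found   = found
... | no  missing = ⊥-elim (FinP.<⇒notInjective (ℕP.n<1+n k) ρ-injective)
  where
  ρ : Fin (suc k) → Fin k
  ρ i = Fin.punchOut {i = j} (λ j≡φi → missing (i , ≡.sym j≡φi))
  ρ-injective : Injective _≡_ _≡_ ρ
  ρ-injective {a} {b} =
    φ-injective ∘ FinP.punchOut-injective (λ j≡φa → missing (a , ≡.sym j≡φa)) (λ j≡φb → missing (b , ≡.sym j≡φb))

module PowerProperties {c ℓ} (K : CommutativeRing c ℓ) where
  open CommutativeRing K
  open import Algebra.Properties.Semiring.Mult semiring using (_×_; ×1-homo-*)
  open import Algebra.Properties.Semiring.Exp semiring using (_^_)

  ×1-homo-^ : ∀ m s → (m ℕ.^ s) × 1# ≈ (m × 1#) ^ s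
  ×1-homo-^ m zero    = +-identityʳ 1#
  ×1-homo-^ m (suc s) = trans (×1-homo-* m (m ℕ.^ s)) (*-congˡ (×1-homo-^ m s))

  0^n≈0 : ∀ {n} → 1 ℕ.≤ n → 0# ^ n ≈ 0#
  0^n≈0 {suc n} _ = zeroˡ _

  1^n≈1 : ∀ n → 1# ^ n ≈ 1#
  1^n≈1 zero    = refl
  1^n≈1 (suc n) = trans (*-identityˡ _) (1^n≈1 n)

module FieldProperties {c ℓ} (K : CommutativeRing c ℓ) (isField : IsField K) where
  open CommutativeRing K
  open import Algebra.Properties.Semiring.Exp semiring using (_^_)
  open import Relation.Binary.Reasoning.Setoid setoid
  open ℤ-Solver K

  1≉0 : 1# ≉ 0#
  1≉0 = proj₁ isField

  inverse : ∀ a → a ≉ 0# → Carrier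
  inverse a a≉0 = proj₁ (proj₂ isField a a≉0)

  *-inverseʳ : ∀ a (a≉0 : a ≉ 0#) → a * inverse a a≉0 ≈ 1#
  *-inverseʳ a a≉0 = proj₂ (proj₂ isField a a≉0)

  *-cancelˡ : ∀ {a x y} → a ≉ 0# → a * x ≈ a * y → x ≈ y
  *-cancelˡ {a} {x} {y} a≉0 ax≈ay = begin
    x              ≈⟨ sym (*-identityˡ x) ⟩
    1# * x         ≈⟨ *-congʳ (sym (*-inverseʳ a a≉0)) ⟩
    (a * a⁻¹) * x  ≈⟨ solve 3 (λ a a⁻¹ x → (a :* a⁻¹) :* x := a⁻¹ :* (a :* x)) refl a a⁻¹ x ⟩
    a⁻¹ * (a * x)  ≈⟨ *-congˡ ax≈ay ⟩
    a⁻¹ * (a * y)  ≈⟨ solve 3 (λ a a⁻¹ y → a⁻¹ :* (a :* y) := (a :* a⁻¹) :* y) refl a a⁻¹ y ⟩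
    (a * a⁻¹) * y  ≈⟨ *-congʳ (*-inverseʳ a a≉0) ⟩
    1# * y         ≈⟨ *-identityˡ y ⟩
    y              ∎
    where
    a⁻¹ : Carrier
    a⁻¹ = inverse a a≉0

  x≉0∧y≉0⇒x*y≉0 : ∀ {x y} → x ≉ 0# → y ≉ 0# → x * y ≉ 0#
  x≉0∧y≉0⇒x*y≉0 {x} x≉0 y≉0 xy≈0 = y≉0 (*-cancelˡ x≉0 (trans xy≈0 (sym (zeroʳ x))))

  x≉0⇒x^n≉0 : ∀ {x} → x ≉ 0# → ∀ n → x ^ n ≉ 0#
  x≉0⇒x^n≉0 x≉0 zero    = 1≉0
  x≉0⇒x^n≉0 x≉0 (suc n) = x≉0∧y≉0⇒x*y≉0 x≉0 (x≉0⇒x^n≉0 x≉0 n)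

  x*y≈1⇒x≉0 : ∀ {x y} → x * y ≈ 1# → x ≉ 0#
  x*y≈1⇒x≉0 {x} {y} xy≈1 x≈0 = 1≉0 (trans (sym xy≈1) (trans (*-congʳ x≈0) (zeroˡ y)))

  x*y≈1⇒y≉0 : ∀ {x y} → x * y ≈ 1# → y ≉ 0#
  x*y≈1⇒y≉0 xy≈1 = x*y≈1⇒x≉0 (trans (*-comm _ _) xy≈1)

-- Polynomials are coefficient lists, lowest degree first.
module PolynomialRoots {c ℓ} (K : CommutativeRing c ℓ) (isField : IsField K) where
  open CommutativeRing K
  open import Data.List using (List; []; _∷_; length)
  open import Data.List.Relation.Unary.All using (All; []; _∷_)
  open import Algebra.Properties.Semiring.Exp semiring using (_^_)
  open import Relation.Binary.Reasoning.Setoid setoid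
  open ℤ-Solver K
  open FieldProperties K isField

  eval : List Carrier → Carrier → Carrier
  eval []       x = 0#
  eval (a ∷ as) x = a + x * eval as x

  -- the quotient of a ∷ as by (x - r), which does not depend on a
  quotient : Carrier → List Carrier → List Carrier
  quotient r []       = []
  quotient r (b ∷ bs) = eval (b ∷ bs) r ∷ quotient r bs

  length-quotient : ∀ r as → length (quotient r as) ≡ length as
  length-quotient r []       = ≡.refl
  length-quotient r (b ∷ bs) = ≡.cong suc (length-quotient r bs)

  eval-division : ∀ r a as x → eval (a ∷ as) x ≈ (x - r) * eval (quotient r as) x + eval (a ∷ as) r
  eval-division r a []       x = solve 3 (λ a x r → a :+ x :* :0 := (x :- r) :* :0 :+ (a :+ r :* :0)) refl a x r
  eval-division r a (b ∷ bs) x = begin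
    a + x * eval (b ∷ bs) x                                       ≈⟨ +-congˡ (*-congˡ (eval-division r b bs x)) ⟩
    a + x * ((x - r) * eval (quotient r bs) x + eval (b ∷ bs) r)  ≈⟨ solve 5 (λ a x r Q E → a :+ x :* ((x :- r) :* Q :+ E) := (x :- r) :* (E :+ x :* Q) :+ (a :+ r :* E))
                                                                       refl a x r (eval (quotient r bs) x) (eval (b ∷ bs) r) ⟩
    (x - r) * (eval (b ∷ bs) r + x * eval (quotient r bs) x) + (a + r * eval (b ∷ bs) r) ∎

  eval-zero : ∀ {as} → All (_≈ 0#) as → ∀ x → eval as x ≈ 0#
  eval-zero []             x = refl
  eval-zero (a≈0 ∷ as≈0) x = trans (+-cong a≈0 (trans (*-congˡ (eval-zero as≈0 x)) (zeroʳ x))) (+-identityˡ 0#)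

  head-zero : ∀ {a as} r → All (_≈ 0#) as → eval (a ∷ as) r ≈ 0# → a ≈ 0#
  head-zero {a} r as≈0 root = trans (sym (trans (+-congˡ (trans (*-congˡ (eval-zero as≈0 r)) (zeroʳ r))) (+-identityʳ a))) root

  quotient-zero : ∀ r as → All (_≈ 0#) (quotient r as) → All (_≈ 0#) as
  quotient-zero r []       _                 = []
  quotient-zero r (b ∷ bs) (root ∷ quot≈0) = head-zero r bs≈0 root ∷ bs≈0
    where
    bs≈0 : All (_≈ 0#) bs
    bs≈0 = quotient-zero r bs quot≈0

  root-bound : ∀ as k (roots : Fin k → Carrier) → length as ℕ.≤ k →
    (∀ {i j} → roots i ≈ roots j → i ≡ j) → (∀ i → eval as (roots i) ≈ 0#) → All (_≈ 0#) as
  root-bound []       k       roots _               _        _       = []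
  root-bound (a ∷ as) (suc k) roots (ℕ.s≤s len≤k) distinct vanishes =
    head-zero r as≈0 (vanishes Fin.zero) ∷ as≈0
    where
    r : Carrier
    r = roots Fin.zero
    quotient-vanishes : ∀ i → eval (quotient r as) (roots (Fin.suc i)) ≈ 0#
    quotient-vanishes i = *-cancelˡ x-r≉0 (begin
      (x - r) * eval (quotient r as) x                       ≈⟨ sym (+-identityʳ _) ⟩
      (x - r) * eval (quotient r as) x + 0#                  ≈⟨ +-congˡ (sym (vanishes Fin.zero)) ⟩
      (x - r) * eval (quotient r as) x + eval (a ∷ as) r     ≈⟨ sym (eval-division r a as x) ⟩
      eval (a ∷ as) x                                        ≈⟨ vanishes (Fin.suc i) ⟩
      0#                                                     ≈⟨ sym (zeroʳ _) ⟩
      (x - r) * 0#                                           ∎)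
      where
      x : Carrier
      x = roots (Fin.suc i)
      x-r≉0 : x - r ≉ 0#
      x-r≉0 x-r≈0 with () ← distinct (begin
        x             ≈⟨ solve 2 (λ x r → x := (x :- r) :+ r) refl x r ⟩
        (x - r) + r   ≈⟨ +-congʳ x-r≈0 ⟩
        0# + r        ≈⟨ +-identityˡ r ⟩
        r             ∎)
    as≈0 : All (_≈ 0#) as
    as≈0 = quotient-zero r as (root-bound (quotient r as) k (roots ∘ Fin.suc)
             (≡.subst (ℕ._≤ k) (≡.sym (length-quotient r as)) len≤k)
             (FinP.suc-injective ∘ distinct) quotient-vanishes)

  monomial : ℕ → List Carrier
  monomial zero    = 1# ∷ []
  monomial (suc k) = 0# ∷ monomial k

  length-monomial : ∀ k → length (monomial k) ≡ suc k
  length-monomial zero    = ≡.refl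
  length-monomial (suc k) = ≡.cong suc (length-monomial k)

  eval-monomial : ∀ k x → eval (monomial k) x ≈ x ^ k
  eval-monomial zero    x = trans (+-congˡ (zeroʳ x)) (+-identityʳ 1#)
  eval-monomial (suc k) x = trans (+-identityˡ _) (*-congˡ (eval-monomial k x))

  monomial≉0 : ∀ k → ¬ All (_≈ 0#) (monomial k)
  monomial≉0 zero    (1≈0 ∷ _)     = 1≉0 1≈0
  monomial≉0 (suc k) (_ ∷ coeffs≈0) = monomial≉0 k coeffs≈0

module FiniteField {c ℓ} (K : CommutativeRing c ℓ) (isField : IsField K)
  {n : ℕ} (e : Fin n → CommutativeRing.Carrier K) (e-bijective : Bijective _≡_ (CommutativeRing._≈_ K) e) where
  open CommutativeRing K
  open import Algebra.Properties.Semiring.Mult semiring using (_×_)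
  open import Algebra.Properties.Semiring.Exp semiring using (_^_; ^-congˡ; ^-assocʳ)
  import Algebra.Properties.CommutativeMonoid.Sum +-commutativeMonoid as Sum
  import Algebra.Properties.CommutativeMonoid.Sum *-commutativeMonoid as Product
  open import Data.Vec.Functional using (replicate)
  open import Data.Fin.Permutation using (Permutation; _⟨$⟩ʳ_; permutation)
  open import Data.List using (List; _∷_)
  open import Relation.Binary.Reasoning.Setoid setoid
  open ℤ-Solver K
  open FieldProperties K isField
  open PowerProperties K

  index : Carrier → Fin n
  index a = proj₁ (proj₂ e-bijective a)

  e∘index : ∀ a → e (index a) ≈ a
  e∘index a = proj₂ (proj₂ e-bijective a) ≡.refl

  index-cong : ∀ {a b} → a ≈ b → index a ≡ index b
  index-cong {a} {b} a≈b = proj₁ e-bijective (trans (e∘index a) (trans a≈b (sym (e∘index b))))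

  index∘e : ∀ i → index (e i) ≡ i
  index∘e i = proj₁ e-bijective (e∘index (e i))

  infix 4 _≟_
  _≟_ : ∀ a b → Dec (a ≈ b)
  a ≟ b with index a FinP.≟ index b
  ... | yes ia≡ib = yes (trans (sym (e∘index a)) (trans (reflexive (≡.cong e ia≡ib)) (e∘index b)))
  ... | no  ia≢ib = no (ia≢ib ∘ index-cong)

  2≤card : 2 ℕ.≤ n
  2≤card = distinct⇒2≤ (index 0#) (index 1#)
    (λ i0≡i1 → 1≉0 (sym (trans (sym (e∘index 0#)) (trans (reflexive (≡.cong e i0≡i1)) (e∘index 1#)))))
    where
    distinct⇒2≤ : ∀ {k} (i j : Fin k) → i ≢ j → 2 ℕ.≤ k
    distinct⇒2≤ {suc (suc _)} _        _        _   = ℕ.s≤s (ℕ.s≤s ℕ.z≤n)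
    distinct⇒2≤ {suc zero}    Fin.zero Fin.zero i≢j = ⊥-elim (i≢j ≡.refl)

  e≈0⇒≡index0 : ∀ {i} → e i ≈ 0# → i ≡ index 0#
  e≈0⇒≡index0 {i} ei≈0 = ≡.trans (≡.sym (index∘e i)) (index-cong ei≈0)

  module InducedPermutation (φ ψ : Carrier → Carrier)
    (φ-cong : ∀ {a b} → a ≈ b → φ a ≈ φ b) (ψ-cong : ∀ {a b} → a ≈ b → ψ a ≈ ψ b)
    (φ∘ψ : ∀ a → φ (ψ a) ≈ a) (ψ∘φ : ∀ a → ψ (φ a) ≈ a) where

    π : Permutation n n
    π = permutation σ τ σ∘τ τ∘σ
      where
      σ τ : Fin n → Fin n
      σ i = index (φ (e i))
      τ i = index (ψ (e i))
      σ∘τ : ∀ i → σ (τ i) ≡ i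
      σ∘τ i = ≡.trans (index-cong (trans (φ-cong (e∘index (ψ (e i)))) (φ∘ψ (e i)))) (index∘e i)
      τ∘σ : ∀ i → τ (σ i) ≡ i
      τ∘σ i = ≡.trans (index-cong (trans (ψ-cong (e∘index (φ (e i)))) (ψ∘φ (e i)))) (index∘e i)

    e∘π : ∀ i → e (π ⟨$⟩ʳ i) ≈ φ (e i)
    e∘π i = e∘index (φ (e i))

  -- Translation by 1 permutes K, so Σ e = Σ (e + 1) = Σ e + n.
  card×1≈0 : n × 1# ≈ 0#
  card×1≈0 = begin
    n × 1#                                          ≈⟨ solve 2 (λ s k → k := (s :+ k) :- s) refl (Sum.sum e) (n × 1#) ⟩
    (Sum.sum e + n × 1#) - Sum.sum e                ≈⟨ +-congʳ (+-congˡ (sym (Sum.sum-replicate n))) ⟩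
    (Sum.sum e + Sum.sum (replicate n 1#)) - Sum.sum e ≈⟨ +-congʳ (sym (Sum.∑-distrib-+ e (replicate n 1#))) ⟩
    Sum.sum (λ i → e i + 1#) - Sum.sum e            ≈⟨ +-congʳ (Sum.sum-cong-≋ (λ i → sym (e∘π i))) ⟩
    Sum.sum (e ∘ (π ⟨$⟩ʳ_)) - Sum.sum e             ≈⟨ +-congʳ (sym (Sum.sum-permute e π)) ⟩
    Sum.sum e - Sum.sum e                           ≈⟨ -‿inverseʳ _ ⟩
    0#                                              ∎
    where
    open InducedPermutation (_+ 1#) (_- 1#) +-congʳ +-congʳ
      (λ a → solve 2 (λ a o → (a :- o) :+ o := a) refl a 1#)
      (λ a → solve 2 (λ a o → (a :+ o) :- o := a) refl a 1#)

  product-agree-except : ∀ {m} (A B : Fin m → Carrier) i x → (∀ j → j ≢ i → A j ≈ B j) → A i * x ≈ B i →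
    Product.sum A * x ≈ Product.sum B
  product-agree-except {suc m} A B i x A≈B Ai*x≈Bi = begin
    Product.sum A * x                                 ≈⟨ *-congʳ (Product.sum-remove A) ⟩
    (A i * Product.sum (A ∘ Fin.punchIn i)) * x       ≈⟨ solve 3 (λ a p x → (a :* p) :* x := (a :* x) :* p) refl (A i) _ x ⟩
    (A i * x) * Product.sum (A ∘ Fin.punchIn i)       ≈⟨ *-cong Ai*x≈Bi (Product.sum-cong-≋ (λ j → A≈B _ (FinP.punchInᵢ≢i i j))) ⟩
    B i * Product.sum (B ∘ Fin.punchIn i)             ≈⟨ sym (Product.sum-remove B) ⟩
    Product.sum B                                     ∎

  e′ : Fin n → Carrier
  e′ i with i FinP.≟ index 0#
  ... | yes _ = 1#
  ... | no  _ = e i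

  e′-at-0 : e′ (index 0#) ≈ 1#
  e′-at-0 with index 0# FinP.≟ index 0#
  ... | yes _ = refl
  ... | no  ¬refl = ⊥-elim (¬refl ≡.refl)

  e′-elsewhere : ∀ i → i ≢ index 0# → e′ i ≈ e i
  e′-elsewhere i i≢0 with i FinP.≟ index 0#
  ... | yes i≡0 = ⊥-elim (i≢0 i≡0)
  ... | no  _   = refl

  e′≉0 : ∀ i → e′ i ≉ 0#
  e′≉0 i with i FinP.≟ index 0#
  ... | yes _   = 1≉0
  ... | no  i≢0 = i≢0 ∘ e≈0⇒≡index0

  -- Multiplication by x ≉ 0 permutes the nonzero elements, so their product P = Π e′ satisfies P x = x^n P.
  x^card≈x : ∀ x → x ^ n ≈ x
  x^card≈x x with x ≟ 0#
  ... | yes x≈0 = trans (^-congˡ n x≈0) (trans (0^n≈0 (ℕP.≤-trans (ℕ.s≤s ℕ.z≤n) 2≤card)) (sym x≈0))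
  ... | no  x≉0 = sym (*-cancelˡ (Π≉0 e′ e′≉0) (begin
    Product.sum e′ * x                 ≈⟨ *-congʳ (Product.sum-permute e′ π) ⟩
    Product.sum (e′ ∘ (π ⟨$⟩ʳ_)) * x   ≈⟨ product-agree-except (e′ ∘ (π ⟨$⟩ʳ_)) (λ i → x * e′ i) (index 0#) x
                                            e′∘π≈x*e′ e′∘π[0]*x≈x*e′[0] ⟩
    Product.sum (λ i → x * e′ i)       ≈⟨ Product.∑-distrib-+ (replicate n x) e′ ⟩
    Product.sum (replicate n x) * Product.sum e′ ≈⟨ *-congʳ (Product.sum-replicate n) ⟩
    x ^ n * Product.sum e′             ≈⟨ *-comm _ _ ⟩
    Product.sum e′ * x ^ n             ∎))
    where
    Π≉0 : ∀ {m} (A : Fin m → Carrier) → (∀ i → A i ≉ 0#) → Product.sum A ≉ 0#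
    Π≉0 {zero}  A A≉0 = 1≉0
    Π≉0 {suc m} A A≉0 = x≉0∧y≉0⇒x*y≉0 (A≉0 Fin.zero) (Π≉0 (A ∘ Fin.suc) (A≉0 ∘ Fin.suc))
    x⁻¹ : Carrier
    x⁻¹ = inverse x x≉0
    x*x⁻¹≈1 : x * x⁻¹ ≈ 1#
    x*x⁻¹≈1 = *-inverseʳ x x≉0
    open InducedPermutation (x *_) (x⁻¹ *_) *-congˡ *-congˡ
      (λ a → trans (sym (*-assoc _ _ _)) (trans (*-congʳ x*x⁻¹≈1) (*-identityˡ a)))
      (λ a → trans (sym (*-assoc _ _ _)) (trans (*-congʳ (trans (*-comm _ _) x*x⁻¹≈1)) (*-identityˡ a)))
    π[0]≡0 : π ⟨$⟩ʳ index 0# ≡ index 0#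
    π[0]≡0 = e≈0⇒≡index0 (trans (e∘π _) (trans (*-congˡ (e∘index 0#)) (zeroʳ x)))
    π-preserves-≢0 : ∀ i → i ≢ index 0# → π ⟨$⟩ʳ i ≢ index 0#
    π-preserves-≢0 i i≢0 πi≡0 = i≢0 (e≈0⇒≡index0 (*-cancelˡ x≉0 (begin
      x * e i          ≈⟨ sym (e∘π i) ⟩
      e (π ⟨$⟩ʳ i)     ≡⟨ ≡.cong e πi≡0 ⟩
      e (index 0#)     ≈⟨ e∘index 0# ⟩
      0#               ≈⟨ sym (zeroʳ x) ⟩
      x * 0#           ∎)))
    e′∘π≈x*e′ : ∀ i → i ≢ index 0# → e′ (π ⟨$⟩ʳ i) ≈ x * e′ i
    e′∘π≈x*e′ i i≢0 = trans (e′-elsewhere _ (π-preserves-≢0 i i≢0)) (trans (e∘π i) (*-congˡ (sym (e′-elsewhere i i≢0))))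
    e′∘π[0]*x≈x*e′[0] : e′ (π ⟨$⟩ʳ index 0#) * x ≈ x * e′ (index 0#)
    e′∘π[0]*x≈x*e′[0] = trans (*-congʳ (trans (reflexive (≡.cong e′ π[0]≡0)) e′-at-0)) (trans (*-comm 1# x) (*-congˡ (sym e′-at-0)))

  injective⇒surjective : (h : Carrier → Carrier) → (∀ {a b} → a ≈ b → h a ≈ h b) → Injective _≈_ _≈_ h → Surjective _≈_ _≈_ h
  injective⇒surjective h h-cong h-injective y = e i , λ z≈ei → trans (h-cong z≈ei) h[e[i]]≈y
    where
    φ : Fin n → Fin n
    φ i = index (h (e i))
    φ-injective : Injective _≡_ _≡_ φ
    φ-injective {i} {j} φi≡φj = proj₁ e-bijective (h-injective (trans (sym (e∘index _)) (trans (reflexive (≡.cong e φi≡φj)) (e∘index _))))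
    i-spec : ∃ λ i → φ i ≡ index y
    i-spec = Fin-injective⇒surjective φ φ-injective (index y)
    i : Fin n
    i = proj₁ i-spec
    h[e[i]]≈y : h (e i) ≈ y
    h[e[i]]≈y = trans (sym (e∘index _)) (trans (reflexive (≡.cong e (proj₂ i-spec))) (e∘index y))

  ¬∀⇒∃¬ : ∀ {ℓ′} (P : Carrier → Set ℓ′) → (∀ x → Dec (P x)) → (∀ {a b} → a ≈ b → P a → P b) →
    ¬ (∀ x → P x) → ∃ λ x → ¬ P x
  ¬∀⇒∃¬ P P? P-resp ¬∀P with FinP.¬∀⟶∃¬ n (P ∘ e) (P? ∘ e) (λ ∀P∘e → ¬∀P (λ x → P-resp (e∘index x) (∀P∘e (index x))))
  ... | i , ¬P[e[i]] = e i , ¬P[e[i]]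

  p^s≡card⇒p×1≈0 : ∀ {p} s → p ℕ.^ s ≡ n → p × 1# ≈ 0#
  p^s≡card⇒p×1≈0 {p} s p^s≡n with p × 1# ≟ 0#
  ... | yes p×1≈0 = p×1≈0
  ... | no  p×1≉0 = ⊥-elim (x≉0⇒x^n≉0 p×1≉0 s (begin
    (p × 1#) ^ s     ≈⟨ sym (×1-homo-^ p s) ⟩
    (p ℕ.^ s) × 1#   ≡⟨ ≡.cong (_× 1#) p^s≡n ⟩
    n × 1#           ≈⟨ card×1≈0 ⟩
    0#               ∎))

  x^[card∸1]≈1 : ∀ x → x ≉ 0# → x ^ (n ∸ 1) ≈ 1#
  x^[card∸1]≈1 x x≉0 = *-cancelˡ x≉0 (begin
    x * x ^ (n ∸ 1)   ≡⟨ ≡.cong (x ^_) (ℕP.m+[n∸m]≡n (ℕP.≤-trans (ℕ.s≤s ℕ.z≤n) 2≤card)) ⟩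
    x ^ n             ≈⟨ x^card≈x x ⟩
    x                 ≈⟨ sym (*-identityʳ x) ⟩
    x * 1#            ∎)

  -- With N = (n - 1)/k: if every x ≉ 0 had x^N = 1, then x^{N+1} - x would vanish on all n ≥ N + 2 elements.
  ∃-root-of-unity : ∀ k → 2 ℕ.≤ k → k ∣ n ∸ 1 → ∃ λ y → y ≉ 1# ∧ y ^ k ≈ 1#
  ∃-root-of-unity k 2≤k (divides zero n∸1≡0)
    with () ← proj₁ (Arithmetic.cofactor-bounds 0 k n 2≤k 2≤card (≡.sym n∸1≡0))
  ∃-root-of-unity k 2≤k (divides N@(suc N′) n∸1≡N*k) =
    c₀ ^ N , c₀^N≉1 , trans (^-assocʳ c₀ N k) (trans (reflexive (≡.cong (c₀ ^_) (≡.sym n∸1≡N*k))) (x^[card∸1]≈1 c₀ c₀≉0))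
    where
    open PolynomialRoots K isField using (eval; root-bound; monomial; monomial≉0; eval-monomial; length-monomial)
    2+N≤n : 2 ℕ.+ N ℕ.≤ n
    2+N≤n = proj₂ (Arithmetic.cofactor-bounds N k n 2≤k 2≤card (≡.sym n∸1≡N*k))
    x^[1+N]-x : List Carrier
    x^[1+N]-x = 0# ∷ - 1# ∷ monomial N′
    eval≈ : ∀ x → eval x^[1+N]-x x ≈ x * (x ^ N - 1#)
    eval≈ x = begin
      0# + x * (- 1# + x * eval (monomial N′) x)  ≈⟨ +-congˡ (*-congˡ (+-congˡ (*-congˡ (eval-monomial N′ x)))) ⟩
      0# + x * (- 1# + x ^ N)                     ≈⟨ solve 3 (λ x o y → :0 :+ x :* (:- o :+ y) := x :* (y :- o)) refl x 1# (x ^ N) ⟩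
      x * (x ^ N - 1#)                            ∎
    not-all : ¬ (∀ x → x ≉ 0# → x ^ N ≈ 1#)
    not-all all = monomial≉0 N′ (tail (tail (root-bound x^[1+N]-x (2 ℕ.+ N) (e ∘ (λ i → Fin.inject≤ i 2+N≤n))
                    (ℕP.≤-reflexive (≡.cong (2 ℕ.+_) (length-monomial N′)))
                    (λ eq → FinP.inject≤-injective 2+N≤n 2+N≤n _ _ (proj₁ e-bijective eq)) vanishes)))
      where
      open import Data.List.Relation.Unary.All using (tail)
      vanishes : ∀ i → eval x^[1+N]-x (e (Fin.inject≤ i 2+N≤n)) ≈ 0#
      vanishes i with e (Fin.inject≤ i 2+N≤n) ≟ 0#
      ... | yes x≈0 = trans (eval≈ _) (trans (*-congʳ x≈0) (zeroˡ _))
      ... | no  x≉0 = trans (eval≈ _) (trans (*-congˡ (+-congʳ (all _ x≉0))) (trans (*-congˡ (-‿inverseʳ 1#)) (zeroʳ _)))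
    P : Carrier → Set ℓ
    P x = x ≉ 0# → x ^ N ≈ 1#
    c-search : ∃ λ x → ¬ P x
    c-search = ¬∀⇒∃¬ P (λ x → Relation.Nullary.¬? (x ≟ 0#) Relation.Nullary.→-dec (x ^ N ≟ 1#))
                 (λ a≈b Pa b≉0 → trans (^-congˡ N (sym a≈b)) (Pa (b≉0 ∘ trans (sym a≈b)))) not-all
    c₀ : Carrier
    c₀ = proj₁ c-search
    c₀≉0 : c₀ ≉ 0#
    c₀≉0 c₀≈0 = proj₂ c-search (λ c₀≉0 → ⊥-elim (c₀≉0 c₀≈0))
    c₀^N≉1 : c₀ ^ N ≉ 1#
    c₀^N≉1 c₀^N≈1 = proj₂ c-search (λ _ → c₀^N≈1)

module PrimeCharacteristic {c ℓ} (K : CommutativeRing c ℓ)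
  {p : ℕ} (p-prime : Data.Nat.Primality.Prime p) (p×1≈0 : CharacteristicDivides K p) where
  open CommutativeRing K
  open import Algebra.Properties.Semiring.Mult semiring using (_×_; ×-congʳ; ×-assocˡ; ×-assoc-*; ×-homo-+; ×1-homo-*)
  open import Algebra.Properties.Semiring.Exp semiring using (_^_; ^-congˡ; ^-assocʳ)
  import Algebra.Properties.CommutativeSemiring.Binomial commutativeSemiring as Binomial
  open import Algebra.Properties.Semiring.Sum semiring using (sum)
  open import Data.Nat.Combinatorics using (nCn≡1)
  open import Data.Nat.DivMod using (m≡m%n+[m/n]*n; m%n<n)
  open import Data.Nat.Divisibility using (m%n≡0⇒n∣m)
  open import Data.Nat.Coprimality using (prime⇒coprime; coprime-Bézout) renaming (sym to coprime-sym)
  open import Data.Nat.GCD using (module Bézout)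
  open import Relation.Binary.Reasoning.Setoid setoid
  open Arithmetic using (prime∣binomial)

  n×0≈0 : ∀ n → n × 0# ≈ 0#
  n×0≈0 zero    = refl
  n×0≈0 (suc n) = trans (+-identityˡ _) (n×0≈0 n)

  p∣n⇒n×x≈0 : ∀ {n} x → p ∣ n → n × x ≈ 0#
  p∣n⇒n×x≈0 x (divides j ≡.refl) = begin
    (j ℕ.* p) × x   ≈⟨ sym (×-assocˡ x j p) ⟩
    j × (p × x)     ≈⟨ ×-congʳ j (×-congʳ p (sym (*-identityˡ x))) ⟩
    j × (p × (1# * x)) ≈⟨ ×-congʳ j (sym (×-assoc-* p 1# x)) ⟩
    j × ((p × 1#) * x) ≈⟨ ×-congʳ j (trans (*-congʳ p×1≈0) (zeroˡ x)) ⟩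
    j × 0#          ≈⟨ n×0≈0 j ⟩
    0#              ∎

  sum-last : ∀ n (g : Fin (suc n) → Carrier) → (∀ i → Fin.toℕ i ≢ n → g i ≈ 0#) → sum g ≈ g (Fin.fromℕ n)
  sum-last zero    g g≈0 = +-identityʳ _
  sum-last (suc n) g g≈0 = begin
    g Fin.zero + sum (g ∘ Fin.suc)
      ≈⟨ +-cong (g≈0 Fin.zero (λ ())) (sum-last n (g ∘ Fin.suc) (λ i i≢n → g≈0 (Fin.suc i) (i≢n ∘ ℕP.suc-injective))) ⟩
    0# + g (Fin.suc (Fin.fromℕ n)) ≈⟨ +-identityˡ _ ⟩
    g (Fin.suc (Fin.fromℕ n))      ∎

  -- Only the outer terms of the binomial expansion survive, since p divides the others.
  ^p-homo-+ : ∀ a b → (a + b) ^ p ≈ a ^ p + b ^ p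
  ^p-homo-+ a b = expand p ≡.refl
    where
    expand : ∀ n → n ≡ p → (a + b) ^ p ≈ a ^ p + b ^ p
    expand zero    ≡.refl = ⊥-elim (ℕ.NonZero.nonZero (Data.Nat.Primality.prime⇒nonZero p-prime))
    expand (suc n) ≡.refl = begin
      (a + b) ^ suc n                              ≈⟨ Binomial.theorem (suc n) a b ⟩
      term Fin.zero + sum (term ∘ Fin.suc)         ≈⟨ +-cong (trans (+-identityʳ _) (*-identityˡ _)) (sum-last n (term ∘ Fin.suc) inner≈0) ⟩
      b ^ suc n + term (Fin.suc (Fin.fromℕ n))     ≈⟨ +-congˡ (last≈ (Fin.suc (Fin.fromℕ n)) (≡.cong suc (FinP.toℕ-fromℕ n))) ⟩
      b ^ suc n + a ^ suc n                        ≈⟨ +-comm _ _ ⟩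
      a ^ suc n + b ^ suc n                        ∎
      where
      term : Fin (suc (suc n)) → Carrier
      term = Binomial.binomialTerm a b (suc n)
      last≈ : ∀ k → Fin.toℕ k ≡ suc n → term k ≈ a ^ suc n
      last≈ k eq rewrite eq | nCn≡1 (suc n) | ℕP.n∸n≡0 (suc n) = trans (+-identityʳ _) (*-identityʳ _)
      inner≈0 : ∀ i → Fin.toℕ i ≢ n → term (Fin.suc i) ≈ 0#
      inner≈0 i i≢n = p∣n⇒n×x≈0 _ (prime∣binomial p-prime (ℕ.s≤s ℕ.z≤n) (ℕ.s≤s (ℕP.≤∧≢⇒< (ℕ.s≤s⁻¹ (FinP.toℕ<n i)) i≢n)))

  ^[p^t]-homo-+ : ∀ t a b → (a + b) ^ (p ℕ.^ t) ≈ a ^ (p ℕ.^ t) + b ^ (p ℕ.^ t)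
  ^[p^t]-homo-+ zero    a b = distribʳ 1# a b
  ^[p^t]-homo-+ (suc t) a b = begin
    (a + b) ^ (p ℕ.* p ℕ.^ t)                     ≈⟨ sym (^-assocʳ (a + b) p (p ℕ.^ t)) ⟩
    ((a + b) ^ p) ^ (p ℕ.^ t)                     ≈⟨ ^-congˡ (p ℕ.^ t) (^p-homo-+ a b) ⟩
    (a ^ p + b ^ p) ^ (p ℕ.^ t)                   ≈⟨ ^[p^t]-homo-+ t (a ^ p) (b ^ p) ⟩
    (a ^ p) ^ (p ℕ.^ t) + (b ^ p) ^ (p ℕ.^ t)     ≈⟨ +-cong (^-assocʳ a p (p ℕ.^ t)) (^-assocʳ b p (p ℕ.^ t)) ⟩
    a ^ (p ℕ.* p ℕ.^ t) + b ^ (p ℕ.* p ℕ.^ t)     ∎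

  instance
    p≢0 : ℕ.NonZero p
    p≢0 = Data.Nat.Primality.prime⇒nonZero p-prime

  -- A Bézout identity between k and p reads 1 = 0 in K.
  k×1≉0 : 1# ≉ 0# → ∀ k → 0 < k → k < p → k × 1# ≉ 0#
  k×1≉0 1≉0 k 0<k k<p k×1≈0 with coprime-Bézout (coprime-sym (prime⇒coprime p-prime {{ℕ.>-nonZero 0<k}} k<p))
  ... | Bézout.+- x y 1+y*p≡x*k = 1≉0 (begin
    1#                          ≈⟨ sym (trans (+-congˡ (p∣n⇒n×x≈0 1# (divides y ≡.refl))) (+-identityʳ 1#)) ⟩
    suc (y ℕ.* p) × 1#          ≡⟨ ≡.cong (_× 1#) 1+y*p≡x*k ⟩
    (x ℕ.* k) × 1#              ≈⟨ ×1-homo-* x k ⟩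
    (x × 1#) * (k × 1#)         ≈⟨ *-congˡ k×1≈0 ⟩
    (x × 1#) * 0#               ≈⟨ zeroʳ _ ⟩
    0#                          ∎)
  ... | Bézout.-+ x y 1+x*k≡y*p = 1≉0 (begin
    1#                          ≈⟨ sym (trans (+-congˡ (trans (×1-homo-* x k) (trans (*-congˡ k×1≈0) (zeroʳ _)))) (+-identityʳ 1#)) ⟩
    suc (x ℕ.* k) × 1#          ≡⟨ ≡.cong (_× 1#) 1+x*k≡y*p ⟩
    (y ℕ.* p) × 1#              ≈⟨ p∣n⇒n×x≈0 1# (divides y ≡.refl) ⟩
    0#                          ∎)

  k×1≈0⇒p∣k : 1# ≉ 0# → ∀ k → k × 1# ≈ 0# → p ∣ k
  k×1≈0⇒p∣k 1≉0 k k×1≈0 with k ℕ.% p in k%p≡r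
  ... | zero   = m%n≡0⇒n∣m k p k%p≡r
  ... | suc r′ = ⊥-elim (k×1≉0 1≉0 (suc r′) (ℕ.s≤s ℕ.z≤n) (≡.subst (_< p) k%p≡r (m%n<n k p)) (begin
    suc r′ × 1#                                    ≈⟨ sym (+-identityʳ _) ⟩
    suc r′ × 1# + 0#                               ≈⟨ +-congˡ (sym (p∣n⇒n×x≈0 1# (divides (k ℕ./ p) ≡.refl))) ⟩
    suc r′ × 1# + ((k ℕ./ p) ℕ.* p) × 1#           ≈⟨ sym (×-homo-+ 1# (suc r′) _) ⟩
    (suc r′ ℕ.+ (k ℕ./ p) ℕ.* p) × 1#              ≡⟨ ≡.cong (λ z → (z ℕ.+ (k ℕ./ p) ℕ.* p) × 1#) (≡.sym k%p≡r) ⟩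
    (k ℕ.% p ℕ.+ (k ℕ./ p) ℕ.* p) × 1#             ≡⟨ ≡.cong (_× 1#) (≡.sym (m≡m%n+[m/n]*n k p)) ⟩
    k × 1#                                         ≈⟨ k×1≈0 ⟩
    0#                                             ∎))

module AdditivePower {c ℓ} (K : CommutativeRing c ℓ) (E : ℕ) (1≤E : 1 ℕ.≤ E) (^E-homo-+ : Additive-^ K E) where
  open CommutativeRing K
  open import Algebra.Properties.Semiring.Exp semiring using (_^_; ^-congˡ)
  open import Relation.Binary.Reasoning.Setoid setoid
  open ℤ-Solver K
  open PowerProperties K

  0^E≈0 : 0# ^ E ≈ 0#
  0^E≈0 = 0^n≈0 1≤E

  ^E-homo-neg : ∀ a → (- a) ^ E ≈ - (a ^ E)
  ^E-homo-neg a = begin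
    (- a) ^ E                      ≈⟨ solve 2 (λ x y → y := (x :+ y) :- x) refl (a ^ E) ((- a) ^ E) ⟩
    (a ^ E + (- a) ^ E) - a ^ E    ≈⟨ +-congʳ (sym (^E-homo-+ a (- a))) ⟩
    (a - a) ^ E - a ^ E            ≈⟨ +-congʳ (trans (^-congˡ E (-‿inverseʳ a)) 0^E≈0) ⟩
    0# - a ^ E                     ≈⟨ +-identityˡ _ ⟩
    - (a ^ E)                      ∎

  ^E-homo-sub : ∀ a b → (a - b) ^ E ≈ a ^ E - b ^ E
  ^E-homo-sub a b = trans (^E-homo-+ a (- b)) (+-congˡ (^E-homo-neg b))

  ^E-homo-Σ< : ∀ n h → Σ< K n h ^ E ≈ Σ< K n (λ i → h i ^ E)
  ^E-homo-Σ< zero    h = 0^E≈0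
  ^E-homo-Σ< (suc n) h = trans (^E-homo-+ _ _) (+-congʳ (^E-homo-Σ< n h))

module SumProperties {c ℓ} (K : CommutativeRing c ℓ) where
  open CommutativeRing K
  open import Algebra.Properties.Semiring.Mult semiring using (_×_; ×-congʳ; ×-homo-+; ×-assoc-*)
  open import Relation.Binary.Reasoning.Setoid setoid
  open ℤ-Solver K

  Σ<-cong : ∀ n {f g} → (∀ j → f j ≈ g j) → Σ< K n f ≈ Σ< K n g
  Σ<-cong zero    f≈g = refl
  Σ<-cong (suc n) f≈g = +-cong (Σ<-cong n f≈g) (f≈g n)

  Σ<-cong< : ∀ n {f g} → (∀ j → j < n → f j ≈ g j) → Σ< K n f ≈ Σ< K n g
  Σ<-cong< zero    f≈g = refl
  Σ<-cong< (suc n) f≈g = +-cong (Σ<-cong< n (λ j j<n → f≈g j (ℕP.m<n⇒m<1+n j<n))) (f≈g n (ℕP.n<1+n n))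

  Σ<-distrib-+ : ∀ n f g → Σ< K n (λ j → f j + g j) ≈ Σ< K n f + Σ< K n g
  Σ<-distrib-+ zero    f g = sym (+-identityʳ 0#)
  Σ<-distrib-+ (suc n) f g = trans (+-congʳ (Σ<-distrib-+ n f g))
    (solve 4 (λ a b c d → (a :+ b) :+ (c :+ d) := (a :+ c) :+ (b :+ d)) refl (Σ< K n f) (Σ< K n g) (f n) (g n))

  Σ<-neg : ∀ n f → Σ< K n (λ j → - f j) ≈ - Σ< K n f
  Σ<-neg zero    f = solve 0 (:0 := :- :0) refl
  Σ<-neg (suc n) f = trans (+-congʳ (Σ<-neg n f)) (solve 2 (λ a b → :- a :+ :- b := :- (a :+ b)) refl (Σ< K n f) (f n))

  Σ<-distribˡ-* : ∀ n a f → Σ< K n (λ j → a * f j) ≈ a * Σ< K n f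
  Σ<-distribˡ-* zero    a f = sym (zeroʳ a)
  Σ<-distribˡ-* (suc n) a f = trans (+-congʳ (Σ<-distribˡ-* n a f)) (sym (distribˡ a _ _))

  Σ<-const : ∀ n a → Σ< K n (λ _ → a) ≈ (n × 1#) * a
  Σ<-const zero    a = sym (zeroˡ a)
  Σ<-const (suc n) a = trans (+-congʳ (Σ<-const n a))
    (trans (+-comm _ _) (sym (trans (distribʳ a 1# (n × 1#)) (+-congʳ (*-identityˡ a)))))

  Σ<-head : ∀ n f → Σ< K (suc n) f ≈ f 0 + Σ< K n (f ∘ suc)
  Σ<-head zero    f = trans (+-identityˡ _) (sym (+-identityʳ _))
  Σ<-head (suc n) f = trans (+-congʳ (Σ<-head n f)) (+-assoc _ _ _)

  weight : ℕ → Carrier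
  weight j = suc j × 1#

  Σ<-telescope : ∀ n (a : ℕ → Carrier) →
    Σ< K n (λ j → weight j * (a (suc (n ∸ suc j)) - a (n ∸ suc j))) ≈ Σ< K (suc n) a - weight n * a 0
  Σ<-telescope zero    a = solve 1 (λ a → :0 := (:0 :+ a) :- (:1 :+ :0) :* a) refl (a 0)
  Σ<-telescope (suc n) a = begin
    Σ< K n g + g n
      ≈⟨ +-cong (Σ<-cong< n (λ j j<n → reflexive (≡.cong (λ k → weight j * (a (suc k) - a k)) (ℕP.+-∸-assoc 1 j<n)))) g[n]≈ ⟩
    Σ< K n (λ j → weight j * (a (suc (suc (n ∸ suc j))) - a (suc (n ∸ suc j)))) + weight n * (a 1 - a 0)
      ≈⟨ +-congʳ (Σ<-telescope n (a ∘ suc)) ⟩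
    (Σ< K (suc n) (a ∘ suc) - weight n * a 1) + weight n * (a 1 - a 0)
      ≈⟨ solve 4 (λ s w a₀ a₁ → (s :- w :* a₁) :+ w :* (a₁ :- a₀) := (a₀ :+ s) :- (a₀ :+ w :* a₀)) refl _ (weight n) (a 0) (a 1) ⟩
    (a 0 + Σ< K (suc n) (a ∘ suc)) - (a 0 + weight n * a 0)
      ≈⟨ +-cong (sym (Σ<-head (suc n) a)) (-‿cong (trans (+-congʳ (sym (*-identityˡ (a 0)))) (sym (distribʳ (a 0) 1# (weight n))))) ⟩
    Σ< K (suc (suc n)) a - weight (suc n) * a 0
      ∎
    where
    g : ℕ → Carrier
    g j = weight j * (a (suc (suc n ∸ suc j)) - a (suc n ∸ suc j))
    g[n]≈ : g n ≈ weight n * (a 1 - a 0)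
    g[n]≈ = reflexive (≡.cong (λ k → weight n * (a (suc k) - a k)) (ℕP.n∸n≡0 n))

  Σ<-weight : ∀ n → Σ< K n weight ≈ Arithmetic.triangle n × 1#
  Σ<-weight zero    = refl
  Σ<-weight (suc n) = trans (+-congʳ (Σ<-weight n)) (sym (×-homo-+ 1# (Arithmetic.triangle n) (suc n)))

module Trace {c ℓ} (K : CommutativeRing c ℓ) (isField : IsField K) (q d : ℕ) (1≤q : 1 ℕ.≤ q)
  (^[q^i]-homo-+ : ∀ i → Additive-^ K (q ℕ.^ i)) (x^[q^d]≈x : ∀ x → Fixed-^ K (q ℕ.^ d) x) where
  open CommutativeRing K
  open import Algebra.Properties.Semiring.Mult semiring using (_×_)
  open import Algebra.Properties.Semiring.Exp semiring using (_^_; ^-congˡ; ^-congʳ; ^-assocʳ; ^-homo-*)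
  open import Algebra.Properties.CommutativeSemiring.Exp commutativeSemiring using (^-distrib-*)
  open import Relation.Binary.Reasoning.Setoid setoid
  open ℤ-Solver K
  open PowerProperties K
  open FieldProperties K isField
  open SumProperties K

  1≤q^i : ∀ i → 1 ℕ.≤ q ℕ.^ i
  1≤q^i = ℕP.m^n>0 q {{ℕ.>-nonZero 1≤q}}

  module ^[q^i] (i : ℕ) = AdditivePower K (q ℕ.^ i) (1≤q^i i) (^[q^i]-homo-+ i)

  ^q-homo-+ : ∀ a b → (a + b) ^ q ≈ a ^ q + b ^ q
  ^q-homo-+ a b = trans (^-congʳ (a + b) (≡.sym q*1≡q)) (trans (^[q^i]-homo-+ 1 a b) (+-cong (^-congʳ a q*1≡q) (^-congʳ b q*1≡q)))
    where
    q*1≡q : q ℕ.* 1 ≡ q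
    q*1≡q = ℕP.*-identityʳ q

  module ^q = AdditivePower K q 1≤q ^q-homo-+

  T : Carrier → Carrier
  T = Tr K q d

  Fixed : Carrier → Set ℓ
  Fixed = Fixed-^ K q

  [x^q^i]^q≈x^q^[1+i] : ∀ x i → (x ^ (q ℕ.^ i)) ^ q ≈ x ^ (q ℕ.^ suc i)
  [x^q^i]^q≈x^q^[1+i] x i = trans (^-assocʳ x (q ℕ.^ i) q) (^-congʳ x (ℕP.*-comm (q ℕ.^ i) q))

  [x^q]^q^i≈x^q^[1+i] : ∀ x i → (x ^ q) ^ (q ℕ.^ i) ≈ x ^ (q ℕ.^ suc i)
  [x^q]^q^i≈x^q^[1+i] x i = ^-assocʳ x q (q ℕ.^ i)

  -- x^{q^d} = x lets the conjugates x^{q^{i+1}} run over the same set as the x^{q^i}.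
  T-rotate : ∀ x → Σ< K d (λ i → x ^ (q ℕ.^ suc i)) ≈ T x
  T-rotate x = begin
    Σ< K d (λ i → x ^ (q ℕ.^ suc i))             ≈⟨ solve 2 (λ s a → s := (a :+ s) :- a) refl _ (x ^ 1) ⟩
    (x ^ 1 + Σ< K d (λ i → x ^ (q ℕ.^ suc i))) - x ^ 1 ≈⟨ +-cong (sym (Σ<-head d (λ i → x ^ (q ℕ.^ i)))) (-‿cong (*-identityʳ x)) ⟩
    (T x + x ^ (q ℕ.^ d)) - x                    ≈⟨ +-congʳ (+-congˡ (x^[q^d]≈x x)) ⟩
    (T x + x) - x                                ≈⟨ solve 2 (λ t x → (t :+ x) :- x := t) refl (T x) x ⟩
    T x                                          ∎

  T-fixed : ∀ x → Fixed (T x)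
  T-fixed x = trans (^q.^E-homo-Σ< d _) (trans (Σ<-cong d ([x^q^i]^q≈x^q^[1+i] x)) (T-rotate x))

  T[x^q]≈T[x] : ∀ x → T (x ^ q) ≈ T x
  T[x^q]≈T[x] x = trans (Σ<-cong d ([x^q]^q^i≈x^q^[1+i] x)) (T-rotate x)

  T-cong : ∀ {a b} → a ≈ b → T a ≈ T b
  T-cong a≈b = Σ<-cong d (λ i → ^-congˡ (q ℕ.^ i) a≈b)

  T-homo-+ : ∀ a b → T (a + b) ≈ T a + T b
  T-homo-+ a b = trans (Σ<-cong d (λ i → ^[q^i]-homo-+ i a b)) (Σ<-distrib-+ d _ _)

  T-homo-sub : ∀ a b → T (a - b) ≈ T a - T b
  T-homo-sub a b = trans (T-homo-+ a (- b)) (+-congˡ (trans (Σ<-cong d (λ i → ^[q^i].^E-homo-neg i b)) (Σ<-neg d _)))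

  fixed⇒x^q^i≈x : ∀ {a} → Fixed a → ∀ i → a ^ (q ℕ.^ i) ≈ a
  fixed⇒x^q^i≈x {a} a-fixed zero    = *-identityʳ a
  fixed⇒x^q^i≈x {a} a-fixed (suc i) =
    trans (sym ([x^q]^q^i≈x^q^[1+i] a i)) (trans (^-congˡ (q ℕ.^ i) a-fixed) (fixed⇒x^q^i≈x a-fixed i))

  T-linear : ∀ {a} → Fixed a → ∀ y → T (a * y) ≈ a * T y
  T-linear {a} a-fixed y =
    trans (Σ<-cong d (λ i → trans (^-distrib-* a y (q ℕ.^ i)) (*-congʳ (fixed⇒x^q^i≈x a-fixed i)))) (Σ<-distribˡ-* d a _)

  T-on-fixed : ∀ {a} → Fixed a → T a ≈ (d × 1#) * a
  T-on-fixed {a} a-fixed = trans (Σ<-cong d (fixed⇒x^q^i≈x a-fixed)) (Σ<-const d a)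

  fixed-* : ∀ {a b} → Fixed a → Fixed b → Fixed (a * b)
  fixed-* a-fixed b-fixed = trans (^-distrib-* _ _ q) (*-cong a-fixed b-fixed)

  fixed-+ : ∀ {a b} → Fixed a → Fixed b → Fixed (a + b)
  fixed-+ a-fixed b-fixed = trans (^q-homo-+ _ _) (+-cong a-fixed b-fixed)

  fixed-neg : ∀ {a} → Fixed a → Fixed (- a)
  fixed-neg a-fixed = trans (^q.^E-homo-neg _) (-‿cong a-fixed)

  fixed-0 : Fixed 0#
  fixed-0 = ^q.0^E≈0

  fixed-1 : Fixed 1#
  fixed-1 = 1^n≈1 q

  fixed-^ : ∀ {a} → Fixed a → ∀ k → Fixed (a ^ k)
  fixed-^ {a} a-fixed k = trans (^-assocʳ a k q) (trans (^-congʳ a (ℕP.*-comm k q)) (trans (sym (^-assocʳ a q k)) (^-congˡ k a-fixed)))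

  fixed-×1 : ∀ k → Fixed (k × 1#)
  fixed-×1 zero    = fixed-0
  fixed-×1 (suc k) = fixed-+ fixed-1 (fixed-×1 k)

  fixed-inverse : ∀ {a b} → Fixed a → a * b ≈ 1# → Fixed b
  fixed-inverse {a} {b} a-fixed a*b≈1 = *-cancelˡ (x*y≈1⇒x≉0 a*b≈1) (begin
    a * b ^ q        ≈⟨ *-congʳ (sym a-fixed) ⟩
    a ^ q * b ^ q    ≈⟨ sym (^-distrib-* a b q) ⟩
    (a * b) ^ q      ≈⟨ ^-congˡ q a*b≈1 ⟩
    1# ^ q           ≈⟨ fixed-1 ⟩
    1#               ≈⟨ sym a*b≈1 ⟩
    a * b            ∎)

  fixed⇒x^k≈x : ∀ {a} → Fixed a → ∀ k → 1 ℕ.≤ k → (q ∸ 1) ∣ (k ∸ 1) → a ^ k ≈ a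
  fixed⇒x^k≈x {a} a-fixed (suc k) _ (divides j ≡.refl) = a^[1+j*Q]≈a j
    where
    Q : ℕ
    Q = q ∸ 1
    1+Q≡q : suc Q ≡ q
    1+Q≡q = ≡.trans (ℕP.+-comm 1 Q) (ℕP.m∸n+n≡m 1≤q)
    a^[1+j*Q]≈a : ∀ j → a ^ suc (j ℕ.* Q) ≈ a
    a^[1+j*Q]≈a zero    = *-identityʳ a
    a^[1+j*Q]≈a (suc j) = begin
      a * a ^ (Q ℕ.+ j ℕ.* Q)            ≈⟨ *-congˡ (^-homo-* a Q (j ℕ.* Q)) ⟩
      a * (a ^ Q * a ^ (j ℕ.* Q))        ≈⟨ sym (*-assoc _ _ _) ⟩
      a ^ suc Q * a ^ (j ℕ.* Q)          ≈⟨ *-congʳ (trans (^-congʳ a 1+Q≡q) a-fixed) ⟩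
      a * a ^ (j ℕ.* Q)                  ≈⟨ a^[1+j*Q]≈a j ⟩
      a                                  ∎

module PermutationPolynomial {c ℓ} (K : CommutativeRing c ℓ) (isField : IsField K) (q n : ℕ) (1≤q : 1 ℕ.≤ q)
  (^[q^i]-homo-+ : ∀ i → Additive-^ K (q ℕ.^ i)) (x^[q^d]≈x : ∀ x → Fixed-^ K (q ℕ.^ suc n) x)
  (u₁ u₂ : CommutativeRing.Carrier K) (u₁-fixed : Fixed-^ K q u₁) (u₂-fixed : Fixed-^ K q u₂) (m : ℕ) where
  open CommutativeRing K
  open import Algebra.Properties.Semiring.Mult semiring using (_×_; ×-congʳ; ×-assoc-*; ×-homo-+; ×1-homo-*)
  open import Algebra.Properties.Semiring.Exp semiring using (_^_; ^-congˡ; ^-assocʳ)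
  open import Algebra.Properties.CommutativeSemiring.Exp commutativeSemiring using (^-distrib-*)
  open import Relation.Binary.Reasoning.Setoid setoid
  open ℤ-Solver K
  open PowerProperties K
  open SumProperties K
  open Trace K isField q (suc n) 1≤q ^[q^i]-homo-+ x^[q^d]≈x public
  open Arithmetic using (even-or-odd; triangle; triangle[h+h]; triangle[1+h+h]; [1+h+h]%2≡1; [2+h+h]%2≡0; [h+h]/2≡h; [1+h+h]/2≡h)

  d : ℕ
  d = suc n

  D : Carrier
  D = d × 1#

  f : Carrier → Carrier
  f = fPoly K q d m u₁ u₂

  f-cong : ∀ {x y} → x ≈ y → f x ≈ f y
  f-cong x≈y = +-cong (*-congˡ (+-cong (^-congˡ q x≈y) (-‿cong x≈y))) (*-congˡ (^-congˡ m (T-cong x≈y)))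

  conj : Carrier → ℕ → Carrier
  conj x i = x ^ (q ℕ.^ i)

  -- the part of f x that lies in 𝔽_q
  C : Carrier → Carrier
  C x = u₂ * T x ^ m

  C-fixed : ∀ x → Fixed (C x)
  C-fixed x = fixed-* u₂-fixed (fixed-^ (T-fixed x) m)

  conj-f : ∀ x i → conj (f x) i ≈ u₁ * (conj x (suc i) - conj x i) + C x
  conj-f x i = begin
    (u₁ * (x ^ q - x) + C x) ^ (q ℕ.^ i)                         ≈⟨ ^[q^i]-homo-+ i _ _ ⟩
    (u₁ * (x ^ q - x)) ^ (q ℕ.^ i) + C x ^ (q ℕ.^ i)             ≈⟨ +-cong (^-distrib-* _ _ (q ℕ.^ i)) (fixed⇒x^q^i≈x (C-fixed x) i) ⟩
    u₁ ^ (q ℕ.^ i) * (x ^ q - x) ^ (q ℕ.^ i) + C x               ≈⟨ +-congʳ (*-cong (fixed⇒x^q^i≈x u₁-fixed i) (^[q^i].^E-homo-sub i _ _)) ⟩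
    u₁ * ((x ^ q) ^ (q ℕ.^ i) - x ^ (q ℕ.^ i)) + C x             ≈⟨ +-congʳ (*-congˡ (+-congʳ ([x^q]^q^i≈x^q^[1+i] x i))) ⟩
    u₁ * (conj x (suc i) - conj x i) + C x                       ∎

  T-f : ∀ x → T (f x) ≈ D * C x
  T-f x = begin
    T (u₁ * (x ^ q - x) + C x)           ≈⟨ T-homo-+ _ _ ⟩
    T (u₁ * (x ^ q - x)) + T (C x)       ≈⟨ +-cong (T-linear u₁-fixed _) (T-on-fixed (C-fixed x)) ⟩
    u₁ * T (x ^ q - x) + D * C x         ≈⟨ +-congʳ (*-congˡ (T-homo-sub _ _)) ⟩
    u₁ * (T (x ^ q) - T x) + D * C x     ≈⟨ +-congʳ (*-congˡ (+-congʳ (T[x^q]≈T[x] x))) ⟩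
    u₁ * (T x - T x) + D * C x           ≈⟨ solve 3 (λ u t y → u :* (t :- t) :+ y := y) refl u₁ (T x) (D * C x) ⟩
    D * C x                              ∎

  S : Carrier → Carrier
  S y = Σ< K n (λ j → suc j × conj y (n ∸ suc j))

  S-f : ∀ x → S (f x) ≈ u₁ * (T x - D * x) + Σ< K n weight * C x
  S-f x = begin
    S (f x)
      ≈⟨ Σ<-cong n (λ j → trans (×-as-* (suc j) _) (*-congˡ (conj-f x (n ∸ suc j)))) ⟩
    Σ< K n (λ j → weight j * (u₁ * δ j + C x))
      ≈⟨ split n ⟩
    u₁ * Σ< K n (λ j → weight j * δ j) + Σ< K n weight * C x
      ≈⟨ +-congʳ (*-congˡ (Σ<-telescope n (conj x))) ⟩
    u₁ * (T x - weight n * conj x 0) + Σ< K n weight * C x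
      ≈⟨ +-congʳ (*-congˡ (+-congˡ (-‿cong (*-congˡ (*-identityʳ x))))) ⟩
    u₁ * (T x - D * x) + Σ< K n weight * C x
      ∎
    where
    δ : ℕ → Carrier
    δ j = conj x (suc (n ∸ suc j)) - conj x (n ∸ suc j)
    ×-as-* : ∀ k z → k × z ≈ (k × 1#) * z
    ×-as-* k z = trans (×-congʳ k (sym (*-identityˡ z))) (sym (×-assoc-* k 1# z))
    split : ∀ k → Σ< K k (λ j → weight j * (u₁ * δ j + C x)) ≈ u₁ * Σ< K k (λ j → weight j * δ j) + Σ< K k weight * C x
    split zero    = solve 2 (λ u c → :0 := u :* :0 :+ :0 :* c) refl u₁ (C x)
    split (suc k) = trans (+-congʳ (split k))
      (solve 6 (λ u s t c w b → (u :* s :+ t :* c) :+ w :* (u :* b :+ c) := u :* (s :+ w :* b) :+ (t :+ w) :* c)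
             refl u₁ _ _ (C x) (weight k) (δ k))

  -- halfDm1 d t is (d - 1)/2 in K, so multiplied by d it gives 1 + 2 + ⋯ + (d - 1).
  halfDm1*D≈Σ<weight : ∀ t → (d % 2 ≡ 0 → t + t ≈ 1#) → halfDm1 K d t * D ≈ Σ< K n weight
  halfDm1*D≈Σ<weight t t+t≈1 with even-or-odd n
  ... | h , inj₁ ≡.refl = begin
    halfDm1 K d t * D                 ≡⟨ ≡.cong (_* D) (≡.trans (odd-case ([1+h+h]%2≡1 h)) (≡.cong (_× 1#) ([h+h]/2≡h h))) ⟩
    (h × 1#) * D                      ≈⟨ sym (×1-homo-* h d) ⟩
    (h ℕ.* d) × 1#                    ≡⟨ ≡.cong (_× 1#) (≡.sym (triangle[h+h] h)) ⟩
    triangle n × 1#                   ≈⟨ sym (Σ<-weight n) ⟩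
    Σ< K n weight                     ∎
    where
    odd-case : d % 2 ≡ 1 → halfDm1 K d t ≡ ((d ∸ 1) ℕ./ 2) × 1#
    odd-case d%2≡1 with d % 2 | d%2≡1
    ... | .1 | ≡.refl = ≡.refl
  ... | h , inj₂ ≡.refl = begin
    halfDm1 K d t * D                 ≡⟨ ≡.cong (_* D) (≡.trans (even-case ([2+h+h]%2≡0 h)) (≡.cong (λ z → z × 1# + t) ([1+h+h]/2≡h h))) ⟩
    (h × 1# + t) * D                  ≈⟨ distribʳ D _ _ ⟩
    (h × 1#) * D + t * D              ≈⟨ +-cong (sym (×1-homo-* h d)) t*D≈[1+h] ⟩
    (h ℕ.* d) × 1# + suc h × 1#       ≈⟨ sym (×-homo-+ 1# (h ℕ.* d) (suc h)) ⟩
    (h ℕ.* d ℕ.+ suc h) × 1#          ≡⟨ ≡.cong (_× 1#) (≡.sym (triangle[1+h+h] h)) ⟩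
    triangle n × 1#                   ≈⟨ sym (Σ<-weight n) ⟩
    Σ< K n weight                     ∎
    where
    even-case : d % 2 ≡ 0 → halfDm1 K d t ≡ ((d ∸ 1) ℕ./ 2) × 1# + t
    even-case d%2≡0 with d % 2 | d%2≡0
    ... | .0 | ≡.refl = ≡.refl
    t*D≈[1+h] : t * D ≈ suc h × 1#
    t*D≈[1+h] = begin
      t * D                             ≡⟨ ≡.cong (λ k → t * (suc k × 1#)) (≡.sym (ℕP.+-suc h h)) ⟩
      t * ((suc h ℕ.+ suc h) × 1#)      ≈⟨ *-congˡ (×-homo-+ 1# (suc h) (suc h)) ⟩
      t * (suc h × 1# + suc h × 1#)     ≈⟨ solve 2 (λ t s → t :* (s :+ s) := (t :+ t) :* s) refl t (suc h × 1#) ⟩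
      (t + t) * (suc h × 1#)            ≈⟨ *-congʳ (t+t≈1 ([2+h+h]%2≡0 h)) ⟩
      1# * (suc h × 1#)                 ≈⟨ *-identityˡ _ ⟩
      suc h × 1#                        ∎

  module Inverse (r : ℕ) (1≤m*r : 1 ℕ.≤ m ℕ.* r) (q-1∣m*r-1 : (q ∸ 1) ∣ (m ℕ.* r ∸ 1)) (dinv w uinv t : Carrier)
    (D*dinv≈1 : D * dinv ≈ 1#) (u₂D*w≈1 : (u₂ * D) * w ≈ 1#) (u₁*uinv≈1 : u₁ * uinv ≈ 1#)
    (t+t≈1 : d % 2 ≡ 0 → t + t ≈ 1#) where

    g : Carrier → Carrier
    g = gPoly K q d r dinv w uinv t

    g-cong : ∀ {x y} → x ≈ y → g x ≈ g y
    g-cong x≈y = +-cong (+-cong (*-congˡ (^-congˡ r (T-cong x≈y))) (*-congˡ (T-cong x≈y)))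
                        (-‿cong (*-congˡ (Σ<-cong n (λ j → ×-congʳ (suc j) (^-congˡ (q ℕ.^ (n ∸ suc j)) x≈y)))))

    -- T x ∈ 𝔽_q and m r ≡ 1 (mod q - 1), so (T x ^ m) ^ r = T x.
    T[f[x]]^r : ∀ x → (dinv * w ^ r) * T (f x) ^ r ≈ dinv * T x
    T[f[x]]^r x = begin
      (dinv * w ^ r) * T (f x) ^ r
        ≈⟨ *-congˡ (^-congˡ r (trans (T-f x) (solve 3 (λ D u t → D :* (u :* t) := (u :* D) :* t) refl D u₂ (T x ^ m)))) ⟩
      (dinv * w ^ r) * ((u₂ * D) * T x ^ m) ^ r
        ≈⟨ *-congˡ (^-distrib-* _ _ r) ⟩
      (dinv * w ^ r) * ((u₂ * D) ^ r * (T x ^ m) ^ r)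
        ≈⟨ *-congˡ (*-congˡ (trans (^-assocʳ (T x) m r) (fixed⇒x^k≈x (T-fixed x) (m ℕ.* r) 1≤m*r q-1∣m*r-1))) ⟩
      (dinv * w ^ r) * ((u₂ * D) ^ r * T x)
        ≈⟨ solve 4 (λ a b c e → (a :* b) :* (c :* e) := a :* ((c :* b) :* e)) refl dinv (w ^ r) ((u₂ * D) ^ r) (T x) ⟩
      dinv * (((u₂ * D) ^ r * w ^ r) * T x)
        ≈⟨ *-congˡ (*-congʳ (sym (^-distrib-* _ _ r))) ⟩
      dinv * (((u₂ * D) * w) ^ r * T x)
        ≈⟨ *-congˡ (*-congʳ (trans (^-congˡ r u₂D*w≈1) (1^n≈1 r))) ⟩
      dinv * (1# * T x)
        ≈⟨ *-congˡ (*-identityˡ _) ⟩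
      dinv * T x
        ∎

    -- After T[f[x]]^r and S-f, the C x terms of the last two summands cancel, as do the T x terms.
    g∘f : ∀ x → g (f x) ≈ x
    g∘f x = begin
      (dinv * w ^ r) * T (f x) ^ r + ((H * dinv) * uinv) * T (f x) - (dinv * uinv) * S (f x)
        ≈⟨ +-cong (+-cong (T[f[x]]^r x) (*-congˡ (T-f x)))
                  (-‿cong (*-congˡ (trans (S-f x) (+-congˡ (*-congʳ (sym (halfDm1*D≈Σ<weight t t+t≈1))))))) ⟩
      dinv * T x + ((H * dinv) * uinv) * (D * C x) - (dinv * uinv) * (u₁ * (T x - D * x) + (H * D) * C x)
        ≈⟨ solve 8 (λ di tx h ui dd cx u x →
                      ((di :* tx) :+ (((h :* di) :* ui) :* (dd :* cx))) :- ((di :* ui) :* (u :* (tx :- dd :* x) :+ (h :* dd) :* cx))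
                    := (di :* tx) :- (u :* ui) :* (di :* tx) :+ (u :* ui) :* ((dd :* di) :* x)) refl dinv (T x) H uinv D (C x) u₁ x ⟩
      dinv * T x - (u₁ * uinv) * (dinv * T x) + (u₁ * uinv) * ((D * dinv) * x)
        ≈⟨ +-cong (+-congˡ (-‿cong (trans (*-congʳ u₁*uinv≈1) (*-identityˡ _))))
                  (trans (*-congʳ u₁*uinv≈1) (trans (*-identityˡ _) (trans (*-congʳ D*dinv≈1) (*-identityˡ x)))) ⟩
      dinv * T x - dinv * T x + x
        ≈⟨ solve 2 (λ a x → a :- a :+ x := x) refl (dinv * T x) x ⟩
      x ∎
      where
      H : Carrier
      H = halfDm1 K d t

  injective⇒T≉0 : Injective _≈_ _≈_ f → ¬ (∀ x → T x ≈ 0#)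
  injective⇒T≉0 f-injective T≈0 = FieldProperties.1≉0 K isField (sym (f-injective (trans (f≈ 0# x^q-x[0]≈0) (sym (f≈ 1# x^q-x[1]≈0)))))
    where
    f≈ : ∀ x → x ^ q - x ≈ 0# → f x ≈ u₁ * 0# + u₂ * 0# ^ m
    f≈ x x^q-x≈0 = +-cong (*-congˡ x^q-x≈0) (*-congˡ (^-congˡ m (T≈0 x)))
    x^q-x[0]≈0 : 0# ^ q - 0# ≈ 0#
    x^q-x[0]≈0 = trans (+-congʳ fixed-0) (-‿inverseʳ 0#)
    x^q-x[1]≈0 : 1# ^ q - 1# ≈ 0#
    x^q-x[1]≈0 = trans (+-congʳ fixed-1) (-‿inverseʳ 1#)

  -- c₀ ∈ 𝔽_q, so x + c₀ has the same x^q - x as x, and trace y T(x), whose m-th power is T(x)^m.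
  collision : ∀ {y dinv} x → Fixed y → y ^ m ≈ 1# → D * dinv ≈ 1# → f (x + ((y - 1#) * T x) * dinv) ≈ f x
  collision {y} {dinv} x y-fixed y^m≈1 D*dinv≈1 = +-cong (*-congˡ x′^q-x′≈x^q-x) (*-congˡ (begin
    T x′ ^ m          ≈⟨ ^-congˡ m T[x′]≈y*T[x] ⟩
    (y * T x) ^ m     ≈⟨ ^-distrib-* y (T x) m ⟩
    y ^ m * T x ^ m   ≈⟨ *-congʳ y^m≈1 ⟩
    1# * T x ^ m      ≈⟨ *-identityˡ _ ⟩
    T x ^ m           ∎))
    where
    c₀ : Carrier
    c₀ = ((y - 1#) * T x) * dinv
    x′ : Carrier
    x′ = x + c₀
    c₀-fixed : Fixed c₀
    c₀-fixed = fixed-* (fixed-* (fixed-+ y-fixed (fixed-neg fixed-1)) (T-fixed x)) (fixed-inverse (fixed-×1 d) D*dinv≈1)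
    T[x′]≈y*T[x] : T x′ ≈ y * T x
    T[x′]≈y*T[x] = begin
      T (x + c₀)                                ≈⟨ T-homo-+ x c₀ ⟩
      T x + T c₀                                ≈⟨ +-congˡ (T-on-fixed c₀-fixed) ⟩
      T x + D * (((y - 1#) * T x) * dinv)       ≈⟨ +-congˡ (solve 3 (λ D a di → D :* (a :* di) := a :* (D :* di)) refl D ((y - 1#) * T x) dinv) ⟩
      T x + ((y - 1#) * T x) * (D * dinv)       ≈⟨ +-congˡ (trans (*-congˡ D*dinv≈1) (*-identityʳ _)) ⟩
      T x + (y - 1#) * T x                      ≈⟨ solve 2 (λ t y → t :+ (y :- :1) :* t := y :* t) refl (T x) y ⟩
      y * T x                                   ∎
    x′^q-x′≈x^q-x : x′ ^ q - x′ ≈ x ^ q - x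
    x′^q-x′≈x^q-x = begin
      (x + c₀) ^ q - (x + c₀)   ≈⟨ +-congʳ (trans (^q-homo-+ x c₀) (+-congˡ c₀-fixed)) ⟩
      (x ^ q + c₀) - (x + c₀)   ≈⟨ solve 3 (λ a c x → (a :+ c) :- (x :+ c) := a :- x) refl (x ^ q) c₀ x ⟩
      x ^ q - x                 ∎

module Criterion {c ℓ} (K : CommutativeRing c ℓ) (isField : IsField K) (n : ℕ)
  {q p s : ℕ} (p-prime : Data.Nat.Primality.Prime p) (0<s : 0 < s) (q≡p^s : q ≡ p ℕ.^ s) (gcd[q,d]≡1 : gcd q (suc n) ≡ 1)
  (e : Fin (q ℕ.^ suc n) → CommutativeRing.Carrier K) (e-bijective : Bijective _≡_ (CommutativeRing._≈_ K) e)
  (u₁ u₂ : CommutativeRing.Carrier K) (u₁-fixed : Fixed-^ K q u₁) (u₁≉0 : ¬ CommutativeRing._≈_ K u₁ (CommutativeRing.0# K))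
  (u₂-fixed : Fixed-^ K q u₂) (u₂≉0 : ¬ CommutativeRing._≈_ K u₂ (CommutativeRing.0# K)) (m : ℕ) (0<m : 0 < m) where
  open CommutativeRing K
  open import Algebra.Properties.Semiring.Mult semiring using (_×_)
  open import Algebra.Properties.Semiring.Exp semiring using (_^_; ^-congˡ; ^-congʳ; ^-assocʳ)
  open import Data.Nat.Divisibility using (∣-trans; ∣-refl; m%n≡0⇒n∣m)
  import Data.Nat.GCD as GCD
  open import Relation.Binary.Reasoning.Setoid setoid
  open ℤ-Solver K
  open PowerProperties K
  open FieldProperties K isField
  open FiniteField K isField e e-bijective

  instance
    p≢0 : ℕ.NonZero p
    p≢0 = Data.Nat.Primality.prime⇒nonZero p-prime

  1≤q : 1 ℕ.≤ q
  1≤q = ≡.subst (1 ℕ.≤_) (≡.sym q≡p^s) (ℕP.m^n>0 p s)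

  q^i≡p^[s*i] : ∀ i → q ℕ.^ i ≡ p ℕ.^ (s ℕ.* i)
  q^i≡p^[s*i] i = ≡.trans (≡.cong (ℕ._^ i) q≡p^s) (ℕP.^-*-assoc p s i)

  p×1≈0 : p × 1# ≈ 0#
  p×1≈0 = p^s≡card⇒p×1≈0 (s ℕ.* suc n) (≡.sym (q^i≡p^[s*i] (suc n)))

  open PrimeCharacteristic K p-prime p×1≈0 using (^[p^t]-homo-+; k×1≈0⇒p∣k)

  ^[q^i]-homo-+ : ∀ i a b → (a + b) ^ (q ℕ.^ i) ≈ a ^ (q ℕ.^ i) + b ^ (q ℕ.^ i)
  ^[q^i]-homo-+ i a b rewrite q^i≡p^[s*i] i = ^[p^t]-homo-+ (s ℕ.* i) a b

  open PermutationPolynomial K isField q n 1≤q ^[q^i]-homo-+ x^card≈x u₁ u₂ u₁-fixed u₂-fixed m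

  -- p divides q, which is coprime to d.
  k∣d⇒k×1≉0 : ∀ k → k ∣ d → k × 1# ≉ 0#
  k∣d⇒k×1≉0 k k∣d k×1≈0 = Arithmetic.prime∤1 p-prime
    (≡.subst (p ∣_) gcd[q,d]≡1 (GCD.gcd-greatest p∣q (∣-trans (k×1≈0⇒p∣k 1≉0 k k×1≈0) k∣d)))
    where
    p∣q : p ∣ q
    p∣q = ≡.subst (p ∣_) (≡.sym q≡p^s) (Arithmetic.m∣m^n p 0<s)

  D≉0 : D ≉ 0#
  D≉0 = k∣d⇒k×1≉0 d ∣-refl

  ∃-half : Σ Carrier λ t → d % 2 ≡ 0 → t + t ≈ 1#
  ∃-half with d % 2 ℕ.≟ 0
  ... | no  d%2≢0 = 0# , λ d%2≡0 → ⊥-elim (d%2≢0 d%2≡0)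
  ... | yes d%2≡0 = t , λ _ → begin
    t + t        ≈⟨ solve 1 (λ t → t :+ t := (:1 :+ (:1 :+ :0)) :* t) refl t ⟩
    (2 × 1#) * t ≈⟨ *-inverseʳ (2 × 1#) 2≉0 ⟩
    1#           ∎
    where
    2≉0 : 2 × 1# ≉ 0#
    2≉0 = k∣d⇒k×1≉0 2 (m%n≡0⇒n∣m d 2 d%2≡0)
    t : Carrier
    t = inverse (2 × 1#) 2≉0

  inverse-formula : IsPermutation K f → (r : ℕ) → 0 < r → (q ∸ 1) ∣ (m ℕ.* r ∸ 1) →
    (dinv w uinv t : Carrier) → D * dinv ≈ 1# → (u₂ * D) * w ≈ 1# → u₁ * uinv ≈ 1# → (d % 2 ≡ 0 → t + t ≈ 1#) →
    (∀ x → gPoly K q d r dinv w uinv t (f x) ≈ x) ∧ (∀ x → f (gPoly K q d r dinv w uinv t x) ≈ x)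
  inverse-formula (_ , f-surjective) r 0<r q-1∣mr-1 dinv w uinv t D*dinv≈1 u₂D*w≈1 u₁*uinv≈1 t+t≈1 = g∘f , f∘g
    where
    open Inverse r (ℕP.*-mono-≤ 0<m 0<r) q-1∣mr-1 dinv w uinv t D*dinv≈1 u₂D*w≈1 u₁*uinv≈1 t+t≈1
    f∘g : ∀ x → f (g x) ≈ x
    f∘g x = trans (f-cong (trans (g-cong (sym f[z]≈x)) (g∘f z))) f[z]≈x
      where
      z : Carrier
      z = proj₁ (f-surjective x)
      f[z]≈x : f z ≈ x
      f[z]≈x = proj₂ (f-surjective x) refl

  coprime⇒permutation : gcd m (q ∸ 1) ≡ 1 → IsPermutation K f
  coprime⇒permutation gcd≡1 = f-injective , injective⇒surjective f f-cong f-injective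
    where
    r-spec : ∃ λ r → 1 ℕ.≤ m ℕ.* r ∧ (q ∸ 1) ∣ m ℕ.* r ∸ 1
    r-spec = Arithmetic.∃-inverse-mod m (q ∸ 1) 0<m gcd≡1
    u₂D≉0 : u₂ * D ≉ 0#
    u₂D≉0 = x≉0∧y≉0⇒x*y≉0 u₂≉0 D≉0
    open Inverse (proj₁ r-spec) (proj₁ (proj₂ r-spec)) (proj₂ (proj₂ r-spec))
      (inverse D D≉0) (inverse (u₂ * D) u₂D≉0) (inverse u₁ u₁≉0) (proj₁ ∃-half)
      (*-inverseʳ D D≉0) (*-inverseʳ (u₂ * D) u₂D≉0) (*-inverseʳ u₁ u₁≉0) (proj₂ ∃-half)
    f-injective : Injective _≈_ _≈_ f
    f-injective {a} {b} fa≈fb = trans (sym (g∘f a)) (trans (g-cong fa≈fb) (g∘f b))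

  gcd≢1⇒∃-fixed-root : gcd m (q ∸ 1) ≢ 1 → ∃ λ y → y ≉ 1# ∧ Fixed y ∧ y ^ m ≈ 1#
  gcd≢1⇒∃-fixed-root gcd≢1 = y , proj₁ (proj₂ y-spec) , y-fixed , y^[j*k]≈1 (GCD.gcd[m,n]∣m m (q ∸ 1))
    where
    k : ℕ
    k = gcd m (q ∸ 1)
    2≤k : 2 ℕ.≤ k
    2≤k = Arithmetic.≢0∧≢1⇒2≤ (ℕP.<⇒≢ 0<m ∘ ≡.sym ∘ GCD.gcd[m,n]≡0⇒m≡0) gcd≢1
    y-spec : ∃ λ y → y ≉ 1# ∧ y ^ k ≈ 1#
    y-spec = ∃-root-of-unity k 2≤k (∣-trans (GCD.gcd[m,n]∣n m (q ∸ 1)) (Arithmetic.[m∸1]∣[m^n∸1] q d))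
    y : Carrier
    y = proj₁ y-spec
    y^[j*k]≈1 : ∀ {j} → k ∣ j → y ^ j ≈ 1#
    y^[j*k]≈1 (divides i ≡.refl) =
      trans (^-congʳ y (ℕP.*-comm i k)) (trans (sym (^-assocʳ y k i)) (trans (^-congˡ i (proj₂ (proj₂ y-spec))) (1^n≈1 i)))
    y-fixed : Fixed y
    y-fixed = trans (reflexive (≡.cong (y ^_) (≡.sym (ℕP.m+[n∸m]≡n 1≤q))))
                    (trans (*-congˡ (y^[j*k]≈1 (GCD.gcd[m,n]∣n m (q ∸ 1)))) (*-identityʳ y))

  permutation⇒coprime : IsPermutation K f → gcd m (q ∸ 1) ≡ 1
  permutation⇒coprime (f-injective , _) with gcd m (q ∸ 1) ℕ.≟ 1
  ... | yes gcd≡1 = gcd≡1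
  ... | no  gcd≢1 with y , y≉1 , y-fixed , y^m≈1 ← gcd≢1⇒∃-fixed-root gcd≢1
                     | x₀ , T[x₀]≉0 ← ¬∀⇒∃¬ (λ x → T x ≈ 0#) (λ x → T x ≟ 0#) (λ a≈b → trans (T-cong (sym a≈b)))
                                            (injective⇒T≉0 f-injective) = ⊥-elim (δ≉0 (begin
    δ               ≈⟨ solve 2 (λ δ x → δ := (x :+ δ) :- x) refl δ x₀ ⟩
    (x₀ + δ) - x₀   ≈⟨ +-congʳ (f-injective (collision x₀ y-fixed y^m≈1 (*-inverseʳ D D≉0))) ⟩
    x₀ - x₀         ≈⟨ -‿inverseʳ x₀ ⟩
    0#              ∎))
    where
    δ : Carrier
    δ = ((y - 1#) * T x₀) * inverse D D≉0
    y-1≉0 : y - 1# ≉ 0#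
    y-1≉0 y-1≈0 = y≉1 (trans (solve 2 (λ y o → y := (y :- o) :+ o) refl y 1#) (trans (+-congʳ y-1≈0) (+-identityˡ 1#)))
    δ≉0 : δ ≉ 0#
    δ≉0 = x≉0∧y≉0⇒x*y≉0 (x≉0∧y≉0⇒x*y≉0 y-1≉0 T[x₀]≉0) (x*y≈1⇒y≉0 (*-inverseʳ D D≉0))

open import Defs using (_^_; _·ℕ_)

theorem6p2 : ∀ {c ℓ : Level} (d q : ℕ) → 1 < d → IsPrimePower q → gcd q d ≡ 1 →
    (K : CommutativeRing c ℓ) → IsField K → HasCard K (q ℕ.^ d) →
    let open CommutativeRing K in
    (u₁ u₂ : Carrier) →
    (_^_ K u₁ q) ≈ u₁ → ¬ (u₁ ≈ 0#) → (_^_ K u₂ q) ≈ u₂ → ¬ (u₂ ≈ 0#) →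
    (m : ℕ) → 0 < m →
    (IsPermutation K (fPoly K q d m u₁ u₂) ⇔ (gcd m (q ∸ 1) ≡ 1))
    ∧ (IsPermutation K (fPoly K q d m u₁ u₂) →
       (r : ℕ) → 0 < r → (q ∸ 1) ∣ (m ℕ.* r ∸ 1) →
       (dinv w uinv t : Carrier) →
       ((_·ℕ_ K d 1#) * dinv) ≈ 1# → ((u₂ * (_·ℕ_ K d 1#)) * w) ≈ 1# → (u₁ * uinv) ≈ 1# →
       (d % 2 ≡ 0 → (t + t) ≈ 1#) →
       (∀ x → gPoly K q d r dinv w uinv t (fPoly K q d m u₁ u₂ x) ≈ x)
       ∧ (∀ x → fPoly K q d m u₁ u₂ (gPoly K q d r dinv w uinv t x) ≈ x))
-- The argument works for every d ≥ 1; the hypothesis 1 < d only serves to exclude d = 0.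
theorem6p2 zero    q () _ _ _ _ _ _ _ _ _ _ _ _ _
theorem6p2 (suc n) q _  (p , s , p-prime , 0<s , q≡p^s) gcd[q,d]≡1 K isField (e , e-bijective)
           u₁ u₂ u₁-fixed u₁≉0 u₂-fixed u₂≉0 m 0<m =
  mk⇔ permutation⇒coprime coprime⇒permutation , inverse-formula
  where open Criterion K isField n p-prime 0<s q≡p^s gcd[q,d]≡1 e e-bijective u₁ u₂ u₁-fixed u₁≉0 u₂-fixed u₂≉0 m 0<m
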